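{- For every $n\geq 1$, the number of join-irreducible elements of the lattice $\mathcal{L}_{n+1}$ of partitions of $n+1$ under the dominance ordering is \[|\mathcal{J}(\mathcal{L}_{n+1})|=n\left(\left\lfloor \frac{n}{3}\right\rfloor+1\right)-\frac{3}{2}\left\lfloor \frac{n}{3}\right\rfloor^{2}-\frac{1}{2}\left\lfloor \frac{n}{3}\right\rfloor.\]
   Context: A partition of a positive integer $n$ is an $n$-tuple $(a_1,\ldots,a_n)$ of natural numbers with $a_1\geq\cdots\geq a_n\geq 0$ and $\sum a_i=n$ (trailing zeros may be omitted). The dominance ordering: $(a_i)\geq(b_i)$ iff $\sum_{i=1}^j a_i\geq\sum_{i=1}^j b_i$ for all $j\geq 1$; partitions of $n$ with this order form a lattice $\mathcal{L}_n$. $\mathcal{J}(\mathcal{L})$ denotes the set of join-irreducible elements of a lattice $\mathcal{L}$, i.e. elements other than the least element that are not the join of two strictly smaller elements (in a finite lattice: elements covering exactly one element). -}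

module Defs where

open import Data.Nat using (ℕ; zero; suc; _+_; _*_; _≤_; _≥_; _/_)
open import Data.Vec using (Vec; []; _∷_)
open import Data.Vec.Relation.Unary.Linked using (Linked)
open import Data.List using (List; length)
open import Data.List.Relation.Unary.Unique.Propositional using (Unique)
open import Data.List.Membership.Propositional using (_∈_)
open import Data.Product using (Σ; ∃; ∃-syntax; _×_)
open import Relation.Nullary using (¬_)
open import Relation.Binary.PropositionalEquality using (_≡_; _≢_)
open import Function.Bundles using (_⇔_)

psum : ∀ {m} → Vec ℕ m → ℕ → ℕ
psum _ zero = 0
psum [] (suc j) = 0
psum (x ∷ xs) (suc j) = x + psum xs j

total : ∀ {m} → Vec ℕ m → ℕ
total [] = 0
total (x ∷ xs) = x + total xs

-- a partition of m: an m-tuple a₁ ≥ ⋯ ≥ aₘ ≥ 0 of naturals summing to m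
IsPartition : (m : ℕ) → Vec ℕ m → Set
IsPartition m a = Linked _≥_ a × total a ≡ m

_⊴_ : ∀ {m} → Vec ℕ m → Vec ℕ m → Set
a ⊴ b = ∀ j → psum a j ≤ psum b j

_◁_ : ∀ {m} → Vec ℕ m → Vec ℕ m → Set
a ◁ b = a ⊴ b × a ≢ b

IsJoin : (m : ℕ) → Vec ℕ m → Vec ℕ m → Vec ℕ m → Set
IsJoin m a b c =
  (b ⊴ a × c ⊴ a) ×
  (∀ d → IsPartition m d → b ⊴ d → c ⊴ d → a ⊴ d)

IsLeast : (m : ℕ) → Vec ℕ m → Set
IsLeast m a = ∀ d → IsPartition m d → a ⊴ d

JoinIrreducible : (m : ℕ) → Vec ℕ m → Set
JoinIrreducible m a =
  IsPartition m a × ¬ IsLeast m a ×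
  ¬ (∃[ b ] ∃[ c ] (IsPartition m b × IsPartition m c × b ◁ a × c ◁ a × IsJoin m a b c))

HasCardinality : (m : ℕ) → ℕ → Set
HasCardinality m k =
  Σ (List (Vec ℕ m)) λ L →
    Unique L × (∀ a → (a ∈ L) ⇔ JoinIrreducible m a) × length L ≡ k

-- The lower covers of a partition a in the dominance order come from moving one unit from the last
-- row i of some part size down to the first row j of a smaller one, where a_i = a_j + 2 or j = i + 1.
-- Conversely, any b strictly below a has partial sums falling short of those of a on a whole interval
-- across which a drops by at least two. Hence a is join-irreducible when every such drop straddles a
-- single legal move, while two disjoint legal moves (or two chained through a step of height one)
-- exhibit a as the join of their results. This singles out the shapes ((h+1)^k, h^(P-k), 1^r) with
-- 1 ≤ k ≤ P and either r = 0 and P ≤ n, or r ≥ 1 and 3P + r ≤ n + 1. There are n of the first kind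
-- and Σ_{P ≥ 1} max(0, n + 1 - 3P) of the second.

{-# OPTIONS --safe #-}
module Submission where

open import Defs
open import Data.Nat using (ℕ; zero; suc; _+_; _*_; _∸_; _≤_; _<_; _≥_; _/_; _%_; z≤n; s≤s; pred; _≟_; _≤?_; _<?_; >-nonZero)
open import Data.Nat.Properties
open import Data.Nat.Solver using (module +-*-Solver)
open import Data.Nat.DivMod using (m≡m%n+[m/n]*n; m%n<n; m/n≡1+[m∸n]/n)
open import Data.Vec using (Vec; []; _∷_)
open import Data.Vec.Relation.Unary.Linked using (Linked; []; [-]; _∷_)
open import Data.List using (List; []; _∷_; _++_; map; length)
open import Data.List.Properties using (length-map; length-++)
open import Data.List.Membership.Propositional using (_∈_)
open import Data.List.Membership.Propositional.Properties using (∈-map⁺; ∈-map⁻; ∈-++⁺ˡ; ∈-++⁺ʳ; ∈-++⁻)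
open import Data.List.Relation.Unary.Any using (here; there)
import Data.List.Relation.Unary.All as All
import Data.List.Relation.Unary.All.Properties as AllP
open import Data.List.Relation.Unary.AllPairs using ([]; _∷_)
open import Data.List.Relation.Unary.Unique.Propositional using (Unique)
import Data.List.Relation.Unary.Unique.Propositional.Properties as Unique
open import Data.Product using (Σ; ∃-syntax; _×_; _,_; proj₁; proj₂)
open import Data.Sum using (_⊎_; inj₁; inj₂)
open import Data.Empty using (⊥-elim)
open import Function.Bundles using (_⇔_; mk⇔; Equivalence)
open import Relation.Binary.Definitions using (tri<; tri≈; tri>)
open import Relation.Nullary using (¬_; Dec; yes; no)
open import Relation.Binary.PropositionalEquality using (_≡_; _≢_; refl; sym; trans; cong; cong₂; subst; subst₂; module ≡-Reasoning)

suc-pred⁺ : ∀ {n} → 1 ≤ n → suc (pred n) ≡ n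
suc-pred⁺ 1≤n = suc-pred _ {{>-nonZero 1≤n}}

2≰1 : ¬ (2 ≤ 1)
2≰1 (s≤s ())

-- The entry a_t, read as 0 beyond the length of the vector.
at : ∀ {m} → Vec ℕ m → ℕ → ℕ
at [] _ = 0
at (x ∷ xs) zero = x
at (x ∷ xs) (suc t) = at xs t

at-≥length : ∀ {m} (a : Vec ℕ m) t → m ≤ t → at a t ≡ 0
at-≥length [] t _ = refl
at-≥length (x ∷ a) (suc t) (s≤s m≤t) = at-≥length a t m≤t

at-ext : ∀ {m} (a b : Vec ℕ m) → (∀ t → t < m → at a t ≡ at b t) → a ≡ b
at-ext [] [] _ = refl
at-ext (x ∷ a) (y ∷ b) eq = cong₂ _∷_ (eq 0 (s≤s z≤n)) (at-ext a b (λ t t<m → eq (suc t) (s≤s t<m)))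

sumBelow : (ℕ → ℕ) → ℕ → ℕ
sumBelow f zero = 0
sumBelow f (suc s) = sumBelow f s + f s

sumBelow-cong : ∀ f g s → (∀ t → t < s → f t ≡ g t) → sumBelow f s ≡ sumBelow g s
sumBelow-cong f g zero _ = refl
sumBelow-cong f g (suc s) eq = cong₂ _+_ (sumBelow-cong f g s (λ t t<s → eq t (m≤n⇒m≤1+n t<s))) (eq s ≤-refl)

sumBelow-+-const : ∀ f s d c → (∀ t → s ≤ t → t < s + d → f t ≡ c) → sumBelow f (s + d) ≡ sumBelow f s + d * c
sumBelow-+-const f s zero c _ = trans (cong (sumBelow f) (+-identityʳ s)) (sym (+-identityʳ _))
sumBelow-+-const f s (suc d) c eq rewrite +-suc s d =
  trans (cong₂ _+_ (sumBelow-+-const f s d c (λ t s≤t t<s+d → eq t s≤t (m<n⇒m<1+n t<s+d)))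
                   (eq (s + d) (m≤m+n s d) ≤-refl))
        (trans (+-assoc (sumBelow f s) (d * c) c) (cong (sumBelow f s +_) (+-comm (d * c) c)))

sumBelow-+-zeros : ∀ f s d → (∀ t → s ≤ t → f t ≡ 0) → sumBelow f (s + d) ≡ sumBelow f s
sumBelow-+-zeros f s d zeros =
  trans (sumBelow-+-const f s d 0 (λ t s≤t _ → zeros t s≤t)) (trans (cong (sumBelow f s +_) (*-zeroʳ d)) (+-identityʳ _))

sumBelow-≥-const : ∀ f c s → (∀ t → t < s → c ≤ f t) → s * c ≤ sumBelow f s
sumBelow-≥-const f c zero _ = z≤n
sumBelow-≥-const f c (suc s) c≤ = ≤-trans (≤-reflexive (+-comm c (s * c)))
  (+-mono-≤ (sumBelow-≥-const f c s (λ t t<s → c≤ t (m<n⇒m<1+n t<s))) (c≤ s ≤-refl))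

sumBelow-≤-id : ∀ f s → (∀ t → f t ≤ 1) → sumBelow f s ≤ s
sumBelow-≤-id f zero _ = z≤n
sumBelow-≤-id f (suc s) ≤1 = ≤-trans (+-mono-≤ (sumBelow-≤-id f s ≤1) (≤1 s)) (≤-reflexive (+-comm s 1))

psum-suc : ∀ {m} (a : Vec ℕ m) t → psum a (suc t) ≡ psum a t + at a t
psum-suc [] zero = refl
psum-suc [] (suc t) = refl
psum-suc (x ∷ a) zero = +-identityʳ x
psum-suc (x ∷ a) (suc t) = trans (cong (x +_) (psum-suc a t)) (sym (+-assoc x (psum a t) (at a t)))

psum≡sumBelow : ∀ {m} (a : Vec ℕ m) s → psum a s ≡ sumBelow (at a) s
psum≡sumBelow a zero = refl
psum≡sumBelow a (suc s) = trans (psum-suc a s) (cong (_+ at a s) (psum≡sumBelow a s))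

psum-≥length : ∀ {m} (a : Vec ℕ m) s → m ≤ s → psum a s ≡ total a
psum-≥length [] zero _ = refl
psum-≥length [] (suc s) _ = refl
psum-≥length (x ∷ a) (suc s) (s≤s m≤s) = cong (x +_) (psum-≥length a s m≤s)

psum≤total : ∀ {m} (a : Vec ℕ m) s → psum a s ≤ total a
psum≤total a zero = z≤n
psum≤total [] (suc s) = z≤n
psum≤total (x ∷ a) (suc s) = +-monoʳ-≤ x (psum≤total a s)

sumBelow≡total : ∀ {m} (a : Vec ℕ m) → sumBelow (at a) m ≡ total a
sumBelow≡total {m} a = trans (sym (psum≡sumBelow a m)) (psum-≥length a m ≤-refl)

Linked⇒at-suc≤ : ∀ {m} {a : Vec ℕ m} → Linked _≥_ a → ∀ t → at a (suc t) ≤ at a t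
Linked⇒at-suc≤ [] t = z≤n
Linked⇒at-suc≤ [-] zero = z≤n
Linked⇒at-suc≤ [-] (suc t) = z≤n
Linked⇒at-suc≤ {a = _ ∷ _ ∷ _} (x≥y ∷ _) zero = x≥y
Linked⇒at-suc≤ (_ ∷ l) (suc t) = Linked⇒at-suc≤ l t

Linked⇒at-antitone : ∀ {m} {a : Vec ℕ m} → Linked _≥_ a → ∀ {t u} → t ≤ u → at a u ≤ at a t
Linked⇒at-antitone {a = a} l {t} t≤u with m≤n⇒∃[o]m+o≡n t≤u
... | d , refl = go d
  where
  go : ∀ d → at a (t + d) ≤ at a t
  go zero rewrite +-identityʳ t = ≤-refl
  go (suc d) rewrite +-suc t d = ≤-trans (Linked⇒at-suc≤ l (t + d)) (go d)

at-suc≤⇒Linked : ∀ {m} (a : Vec ℕ m) → (∀ t → at a (suc t) ≤ at a t) → Linked _≥_ a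
at-suc≤⇒Linked [] _ = []
at-suc≤⇒Linked (x ∷ []) _ = [-]
at-suc≤⇒Linked (x ∷ y ∷ a) dec = dec 0 ∷ at-suc≤⇒Linked (y ∷ a) (λ t → dec (suc t))

fromFunction : (ℕ → ℕ) → (m : ℕ) → Vec ℕ m
fromFunction f zero = []
fromFunction f (suc m) = f 0 ∷ fromFunction (λ t → f (suc t)) m

at-fromFunction< : ∀ f m t → t < m → at (fromFunction f m) t ≡ f t
at-fromFunction< f (suc m) zero _ = refl
at-fromFunction< f (suc m) (suc t) (s≤s t<m) = at-fromFunction< (λ t → f (suc t)) m t t<m

at-fromFunction : ∀ f m → (∀ t → m ≤ t → f t ≡ 0) → ∀ t → at (fromFunction f m) t ≡ f t
at-fromFunction f m zeros t with t <? m
... | yes t<m = at-fromFunction< f m t t<m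
... | no t≮m = trans (at-≥length (fromFunction f m) t (≮⇒≥ t≮m)) (sym (zeros t (≮⇒≥ t≮m)))

fromFunction-IsPartition : ∀ f m → (∀ t → m ≤ t → f t ≡ 0) → (∀ t → f (suc t) ≤ f t) → sumBelow f m ≡ m →
  IsPartition m (fromFunction f m)
fromFunction-IsPartition f m zeros antitone sum =
  at-suc≤⇒Linked a (λ t → subst₂ _≤_ (sym (at-a (suc t))) (sym (at-a t)) (antitone t)) ,
  trans (sym (sumBelow≡total a)) (trans (sumBelow-cong _ _ m (λ t _ → at-a t)) sum)
  where
  a = fromFunction f m
  at-a : ∀ t → at a t ≡ f t
  at-a = at-fromFunction f m zeros

◁⇒psum< : ∀ {m} (b a : Vec ℕ m) → b ⊴ a → b ≢ a → ∃[ s ] psum b s < psum a s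
◁⇒psum< [] [] _ b≢a = ⊥-elim (b≢a refl)
◁⇒psum< (y ∷ b) (x ∷ a) b⊴a b≢a with y ≟ x
... | yes refl with ◁⇒psum< b a (λ j → +-cancelˡ-≤ y _ _ (b⊴a (suc j))) (λ b≡a → b≢a (cong (y ∷_) b≡a))
...   | s , lt = suc s , +-monoʳ-< y lt
◁⇒psum< (y ∷ b) (x ∷ a) b⊴a _ | no y≢x = 1 , ≤∧≢⇒< (b⊴a 1) (λ eq → y≢x (+-cancelʳ-≡ 0 y x eq))

module Runs (P : ℕ → Set) (P? : ∀ n → Dec (P n)) where

  lastBefore : ∀ s → P 0 → ¬ P s → ∃[ p ] (p < s × P p × (∀ q → p < q → q ≤ s → ¬ P q))
  lastBefore zero P0 ¬Ps = ⊥-elim (¬Ps P0)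
  lastBefore (suc s) P0 ¬Ps+1 with P? s
  ... | yes Ps = s , ≤-refl , Ps , λ q s<q q≤s+1 → subst (λ z → ¬ P z) (≤-antisym s<q q≤s+1) ¬Ps+1
  ... | no ¬Ps with lastBefore s P0 ¬Ps
  ...   | p , p<s , Pp , gap = p , m<n⇒m<1+n p<s , Pp , λ q p<q q≤s+1 → extend q p<q (m≤n⇒m<n∨m≡n q≤s+1)
    where
    extend : ∀ q → p < q → q < suc s ⊎ q ≡ suc s → ¬ P q
    extend q p<q (inj₁ q<s+1) = gap q p<q (≤-pred q<s+1)
    extend q p<q (inj₂ refl) = ¬Ps+1

  firstAfter : ∀ d s → ¬ P s → P (s + d) → ∃[ j ] (s ≤ j × P (suc j) × (∀ q → s ≤ q → q ≤ j → ¬ P q))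
  firstAfter zero s ¬Ps Ps+0 = ⊥-elim (¬Ps (subst P (+-identityʳ s) Ps+0))
  firstAfter (suc d) s ¬Ps Ps+d+1 with P? (suc s)
  ... | yes Ps+1 = s , ≤-refl , Ps+1 , λ q s≤q q≤s → subst (λ z → ¬ P z) (≤-antisym s≤q q≤s) ¬Ps
  ... | no ¬Ps+1 with firstAfter d (suc s) ¬Ps+1 (subst P (+-suc s d) Ps+d+1)
  ...   | j , s<j , Pj+1 , gap = j , <⇒≤ s<j , Pj+1 , λ q s≤q q≤j → extend q q≤j (m≤n⇒m<n∨m≡n s≤q)
    where
    extend : ∀ q → q ≤ j → s < q ⊎ s ≡ q → ¬ P q
    extend q q≤j (inj₁ s<q) = gap q s<q q≤j
    extend q q≤j (inj₂ refl) = ¬Ps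

◁⇒deficitInterval : ∀ {m} (b a : Vec ℕ m) → total b ≡ total a → b ⊴ a → b ≢ a →
  ∃[ p ] ∃[ j ] (p < j × psum b p ≡ psum a p × psum b (suc j) ≡ psum a (suc j) ×
                 (∀ s → p < s → s ≤ j → psum b s < psum a s))
◁⇒deficitInterval {m} b a tot b⊴a b≢a with ◁⇒psum< b a b⊴a b≢a
... | s , bs<as with lastBefore s refl (<⇒≢ bs<as) | firstAfter m s (<⇒≢ bs<as) equal-at-end
  where
  open Runs (λ s → psum b s ≡ psum a s) (λ s → psum b s ≟ psum a s)
  equal-at-end : psum b (s + m) ≡ psum a (s + m)
  equal-at-end = trans (psum-≥length b (s + m) (m≤n+m m s))
                   (trans tot (sym (psum-≥length a (s + m) (m≤n+m m s))))
... | p , p<s , eq-p , gap₁ | j , s≤j , eq-j+1 , gap₂ =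
  p , j , <-≤-trans p<s s≤j , eq-p , eq-j+1 , λ q p<q q≤j → ≤∧≢⇒< (b⊴a q) (unequal q p<q q≤j)
  where
  unequal : ∀ q → p < q → q ≤ j → psum b q ≢ psum a q
  unequal q p<q q≤j with q ≤? s
  ... | yes q≤s = gap₁ q p<q q≤s
  ... | no q≰s = gap₂ q (<⇒≤ (≰⇒> q≰s)) q≤j

Drop : ∀ {m} → Vec ℕ m → ℕ → ℕ → Set
Drop a i j = 2 + at a j ≤ at a i

-- Across a deficit interval (p, j], a exceeds b in row p and b catches up in row j; as b is
-- antitone this forces a_p ≥ b_p + 1 ≥ b_j + 1 ≥ a_j + 2.
◁⇒Drop : ∀ {m} (b a : Vec ℕ m) → Linked _≥_ b → total b ≡ total a → b ⊴ a → b ≢ a →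
  ∃[ i ] ∃[ j ] (i < j × j < m × Drop a i j × (∀ s → i < s → s ≤ j → psum b s < psum a s))
◁⇒Drop {m} b a b-antitone tot b⊴a b≢a with ◁⇒deficitInterval b a tot b⊴a b≢a
... | p , j , p<j , eq-p , eq-j+1 , deficit = p , j , p<j , j<m , drop , deficit
  where
  bp<ap : at b p < at a p
  bp<ap = +-cancelˡ-< (psum a p) _ _
    (subst₂ _<_ (trans (psum-suc b p) (cong (_+ at b p) eq-p)) (psum-suc a p) (deficit (suc p) ≤-refl p<j))
  aj<bj : at a j < at b j
  aj<bj = +-cancelˡ-< (psum b j) _ _
    (<-≤-trans (+-monoˡ-< (at a j) (deficit j p<j ≤-refl))
      (≤-reflexive (trans (sym (psum-suc a j)) (trans (sym eq-j+1) (psum-suc b j)))))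
  drop : Drop a p j
  drop = ≤-trans (s≤s (<-≤-trans aj<bj (Linked⇒at-antitone b-antitone (<⇒≤ p<j)))) bp<ap
  j<m : j < m
  j<m with j <? m
  ... | yes j<m = j<m
  ... | no j≮m = ⊥-elim (<⇒≢ aj<bj (trans (at-≥length a j (≮⇒≥ j≮m)) (sym (at-≥length b j (≮⇒≥ j≮m)))))

abstract
  moveUnit : (ℕ → ℕ) → ℕ → ℕ → ℕ → ℕ
  moveUnit g i j t with t ≟ i | t ≟ j
  ... | yes _ | _ = pred (g t)
  ... | no _ | yes _ = suc (g t)
  ... | no _ | no _ = g t

  moveUnit-source : ∀ g i j → moveUnit g i j i ≡ pred (g i)
  moveUnit-source g i j with i ≟ i | i ≟ j
  ... | yes _ | _ = refl
  ... | no i≢i | _ = ⊥-elim (i≢i refl)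

  moveUnit-target : ∀ g i j → i ≢ j → moveUnit g i j j ≡ suc (g j)
  moveUnit-target g i j i≢j with j ≟ i | j ≟ j
  ... | yes j≡i | _ = ⊥-elim (i≢j (sym j≡i))
  ... | no _ | yes _ = refl
  ... | no _ | no j≢j = ⊥-elim (j≢j refl)

  moveUnit-other : ∀ g i j t → t ≢ i → t ≢ j → moveUnit g i j t ≡ g t
  moveUnit-other g i j t t≢i t≢j with t ≟ i | t ≟ j
  ... | yes t≡i | _ = ⊥-elim (t≢i t≡i)
  ... | no _ | yes t≡j = ⊥-elim (t≢j t≡j)
  ... | no _ | no _ = refl

sumBelow-moveUnit-≤ : ∀ g i j s → i < j → s ≤ i → sumBelow (moveUnit g i j) s ≡ sumBelow g s
sumBelow-moveUnit-≤ g i j zero _ _ = refl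
sumBelow-moveUnit-≤ g i j (suc s) i<j s<i = cong₂ _+_ (sumBelow-moveUnit-≤ g i j s i<j (≤-trans (n≤1+n s) s<i))
  (moveUnit-other g i j s (<⇒≢ s<i) (<⇒≢ (<-trans s<i i<j)))

sumBelow-moveUnit-between : ∀ g i j s → i < j → 1 ≤ g i → i < s → s ≤ j →
  suc (sumBelow (moveUnit g i j) s) ≡ sumBelow g s
sumBelow-moveUnit-between g i j (suc s) i<j gi≥1 i<s+1 s<j with s ≟ i
... | yes refl rewrite sumBelow-moveUnit-≤ g s j s i<j ≤-refl | moveUnit-source g s j =
      trans (sym (+-suc (sumBelow g s) (pred (g s)))) (cong (sumBelow g s +_) (suc-pred⁺ gi≥1))
... | no s≢i = cong₂ _+_ (sumBelow-moveUnit-between g i j s i<j gi≥1 i<s (≤-trans (n≤1+n s) s<j))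
                        (moveUnit-other g i j s s≢i (<⇒≢ s<j))
  where
  i<s : i < s
  i<s = ≤∧≢⇒< (≤-pred i<s+1) (λ i≡s → s≢i (sym i≡s))

sumBelow-moveUnit-> : ∀ g i j s → i < j → 1 ≤ g i → j < s → sumBelow (moveUnit g i j) s ≡ sumBelow g s
sumBelow-moveUnit-> g i j (suc s) i<j gi≥1 j<s+1 with s ≟ j
... | yes refl rewrite moveUnit-target g i s (<⇒≢ i<j) =
      trans (+-suc _ (g s)) (cong (_+ g s) (sumBelow-moveUnit-between g i s s i<j gi≥1 i<j ≤-refl))
... | no s≢j = cong₂ _+_ (sumBelow-moveUnit-> g i j s i<j gi≥1 j<s)
                        (moveUnit-other g i j s (λ s≡i → <⇒≢ (<-trans i<j j<s) (sym s≡i)) s≢j)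
  where
  j<s : j < s
  j<s = ≤∧≢⇒< (≤-pred j<s+1) (λ j≡s → s≢j (sym j≡s))

-- Exactly the conditions under which moving a unit from row i down to row j keeps the rows antitone.
record LegalMove {m} (a : Vec ℕ m) (i j : ℕ) : Set where
  constructor legal
  field
    i<j : i < j
    j<m : j < m
    source-drops : at a (suc i) < at a i
    target-rises : at a j < at a (pred j)
    adjacent-drop : j ≡ suc i → Drop a i j

moveUnit-antitone : ∀ {m} {a : Vec ℕ m} {i j} → Linked _≥_ a → LegalMove a i j →
  ∀ t → moveUnit (at a) i j (suc t) ≤ moveUnit (at a) i j t
moveUnit-antitone {a = a} {i} {j} l (legal i<j _ c₁ c₂ c₃) t with t ≟ i
... | yes refl rewrite moveUnit-source (at a) t j with suc t ≟ j
...   | yes refl rewrite moveUnit-target (at a) t (suc t) (<⇒≢ i<j) = <⇒≤pred (c₃ refl)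
...   | no t+1≢j rewrite moveUnit-other (at a) t j (suc t) (λ eq → 1+n≢n eq) t+1≢j = <⇒≤pred c₁
moveUnit-antitone {a = a} {i} {j} l (legal i<j _ c₁ c₂ c₃) t | no t≢i with t ≟ j
... | yes refl rewrite moveUnit-target (at a) i t (<⇒≢ i<j)
      | moveUnit-other (at a) i t (suc t) (λ eq → <⇒≢ (<-trans i<j (n<1+n t)) (sym eq)) (λ eq → 1+n≢n eq) =
      m≤n⇒m≤1+n (Linked⇒at-suc≤ l t)
... | no t≢j rewrite moveUnit-other (at a) i j t t≢i t≢j with suc t ≟ i
...   | yes refl rewrite moveUnit-source (at a) (suc t) j = ≤-trans pred[n]≤n (Linked⇒at-suc≤ l t)
...   | no t+1≢i with suc t ≟ j
...     | yes refl rewrite moveUnit-target (at a) i (suc t) (<⇒≢ i<j) = c₂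
...     | no t+1≢j rewrite moveUnit-other (at a) i j (suc t) t+1≢i t+1≢j = Linked⇒at-suc≤ l t

splitAt : ∀ i j s → s ≤ i ⊎ ((i < s × s ≤ j) ⊎ j < s)
splitAt i j s with s ≤? i
... | yes s≤i = inj₁ s≤i
... | no s≰i with s ≤? j
...   | yes s≤j = inj₂ (inj₁ (≰⇒> s≰i , s≤j))
...   | no s≰j = inj₂ (inj₂ (≰⇒> s≰j))

module Move {m} {a : Vec ℕ m} (pa : IsPartition m a) {i j} (mv : LegalMove a i j) where
  open LegalMove mv

  private
    g = at a
    gi≥1 : 1 ≤ g i
    gi≥1 = ≤-trans (s≤s z≤n) source-drops
    zeros : ∀ t → m ≤ t → moveUnit g i j t ≡ 0
    zeros t m≤t = trans (moveUnit-other g i j t (λ t≡i → <⇒≱ (<-trans i<j j<m) (≤-trans m≤t (≤-reflexive t≡i)))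
                                                (λ t≡j → <⇒≱ j<m (≤-trans m≤t (≤-reflexive t≡j))))
                        (at-≥length a t m≤t)

  result : Vec ℕ m
  result = fromFunction (moveUnit g i j) m

  private
    psum-result : ∀ s → psum result s ≡ sumBelow (moveUnit g i j) s
    psum-result s = trans (psum≡sumBelow result s) (sumBelow-cong _ _ s (λ t _ → at-fromFunction _ m zeros t))

  psum-between : ∀ s → i < s → s ≤ j → suc (psum result s) ≡ psum a s
  psum-between s i<s s≤j = trans (cong suc (psum-result s))
    (trans (sumBelow-moveUnit-between g i j s i<j gi≥1 i<s s≤j) (sym (psum≡sumBelow a s)))

  psum-outside : ∀ s → s ≤ i ⊎ j < s → psum result s ≡ psum a s
  psum-outside s (inj₁ s≤i) = trans (psum-result s) (trans (sumBelow-moveUnit-≤ g i j s i<j s≤i) (sym (psum≡sumBelow a s)))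
  psum-outside s (inj₂ j<s) = trans (psum-result s) (trans (sumBelow-moveUnit-> g i j s i<j gi≥1 j<s) (sym (psum≡sumBelow a s)))

  isPartition : IsPartition m result
  isPartition = fromFunction-IsPartition (moveUnit g i j) m zeros (moveUnit-antitone (proj₁ pa) mv)
    (trans (sym (psum-result m)) (trans (psum-outside m (inj₂ j<m)) (trans (psum-≥length a m ≤-refl) (proj₂ pa))))

  result◁a : result ◁ a
  result◁a = below , λ eq → 1+n≢n (trans (psum-between (suc i) ≤-refl i<j) (sym (cong (λ z → psum z (suc i)) eq)))
    where
    below : result ⊴ a
    below s with splitAt i j s
    ... | inj₁ s≤i = ≤-reflexive (psum-outside s (inj₁ s≤i))
    ... | inj₂ (inj₁ (i<s , s≤j)) = ≤-trans (n≤1+n _) (≤-reflexive (psum-between s i<s s≤j))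
    ... | inj₂ (inj₂ j<s) = ≤-reflexive (psum-outside s (inj₂ j<s))

-- Join-irreducibility criteria

IsProperJoin : (m : ℕ) → Vec ℕ m → Set
IsProperJoin m a = ∃[ b ] ∃[ c ] (IsPartition m b × IsPartition m c × b ◁ a × c ◁ a × IsJoin m a b c)

DropsStraddle : ∀ {m} → Vec ℕ m → ℕ → ℕ → Set
DropsStraddle {m} a i j = ∀ {i′ j′} → i′ < j′ → j′ < m → Drop a i′ j′ → i′ ≤ i × j ≤ j′

module _ {m} {a : Vec ℕ m} (pa : IsPartition m a) {i j} (mv : LegalMove a i j) (straddle : DropsStraddle a i j) where
  open Move pa mv

  ◁⇒⊴moveResult : ∀ b → IsPartition m b → b ◁ a → b ⊴ result
  ◁⇒⊴moveResult b pb (b⊴a , b≢a) s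
    with ◁⇒Drop b a (proj₁ pb) (trans (proj₂ pb) (sym (proj₂ pa))) b⊴a b≢a
  ... | i′ , j′ , i′<j′ , j′<m , drop , deficit with straddle i′<j′ j′<m drop | splitAt i j s
  ...   | _ , _ | inj₁ s≤i = ≤-trans (b⊴a s) (≤-reflexive (sym (psum-outside s (inj₁ s≤i))))
  ...   | i′≤i , j≤j′ | inj₂ (inj₁ (i<s , s≤j)) =
          ≤-pred (≤-trans (deficit s (≤-<-trans i′≤i i<s) (≤-trans s≤j j≤j′)) (≤-reflexive (sym (psum-between s i<s s≤j))))
  ...   | _ , _ | inj₂ (inj₂ j<s) = ≤-trans (b⊴a s) (≤-reflexive (sym (psum-outside s (inj₂ j<s))))

  -- Every element strictly below a lies below `result`, so no join of two of them reaches a.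
  straddle⇒¬IsProperJoin : ¬ IsProperJoin m a
  straddle⇒¬IsProperJoin (b , c , pb , pc , b◁a , c◁a , _ , least) =
    1+n≰n (subst (_≤ psum result (suc i)) (sym (psum-between (suc i) ≤-refl i<j))
      (least result isPartition (◁⇒⊴moveResult b pb b◁a) (◁⇒⊴moveResult c pc c◁a) (suc i)))
    where open LegalMove mv

ones : (m : ℕ) → Vec ℕ m
ones zero = []
ones (suc m) = 1 ∷ ones m

ones-IsPartition : ∀ m → IsPartition m (ones m)
ones-IsPartition m = at-suc≤⇒Linked (ones m) (antitone m) , total-ones m
  where
  ≤1 : ∀ m t → at (ones m) t ≤ 1
  ≤1 zero t = z≤n
  ≤1 (suc m) zero = ≤-refl
  ≤1 (suc m) (suc t) = ≤1 m t
  antitone : ∀ m t → at (ones m) (suc t) ≤ at (ones m) t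
  antitone zero t = z≤n
  antitone (suc m) zero = ≤1 m 0
  antitone (suc m) (suc t) = antitone m t
  total-ones : ∀ m → total (ones m) ≡ m
  total-ones zero = refl
  total-ones (suc m) = cong suc (total-ones m)

head≥2⇒¬IsLeast : ∀ {m} (a : Vec ℕ (suc m)) → 2 ≤ at a 0 → ¬ IsLeast (suc m) a
head≥2⇒¬IsLeast {m} (x ∷ a) x≥2 least =
  <⇒≱ x≥2 (≤-trans (≤-reflexive (sym (+-identityʳ x))) (least (ones (suc m)) (ones-IsPartition (suc m)) 1))

IsPartition⇒psum≥ : ∀ {m} (d : Vec ℕ m) → IsPartition m d → ∀ j → j ≤ m → j ≤ psum d j
IsPartition⇒psum≥ d pd zero _ = z≤n
IsPartition⇒psum≥ {m} d pd (suc j) j<m with at d j ≟ 0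
... | no dj≢0 = subst (suc j ≤_) (sym (psum-suc d j))
      (≤-trans (≤-reflexive (+-comm 1 j)) (+-mono-≤ (IsPartition⇒psum≥ d pd j (<⇒≤ j<m)) (n≢0⇒n>0 dj≢0)))
... | yes dj≡0 = ≤-trans j<m (≤-reflexive (sym psum≡m))
  where
  zeros : ∀ t → j ≤ t → at d t ≡ 0
  zeros t j≤t = n≤0⇒n≡0 (≤-trans (Linked⇒at-antitone (proj₁ pd) j≤t) (≤-reflexive dj≡0))
  psum≡m : psum d (suc j) ≡ m
  psum≡m = begin
    psum d (suc j)                   ≡⟨ psum≡sumBelow d (suc j) ⟩
    sumBelow (at d) (suc j)          ≡⟨ sym (sumBelow-+-zeros (at d) (suc j) (m ∸ suc j) (λ t j<t → zeros t (<⇒≤ j<t))) ⟩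
    sumBelow (at d) (suc j + (m ∸ suc j)) ≡⟨ cong (sumBelow (at d)) (m+[n∸m]≡n j<m) ⟩
    sumBelow (at d) m                ≡⟨ sumBelow≡total d ⟩
    total d                          ≡⟨ proj₂ pd ⟩
    m                                ∎
    where open ≡-Reasoning

head≤1⇒IsLeast : ∀ {m} (a : Vec ℕ m) → IsPartition m a → at a 0 ≤ 1 → IsLeast m a
head≤1⇒IsLeast {m} a pa a₀≤1 d pd j with j ≤? m
... | yes j≤m = ≤-trans (≤-trans (≤-reflexive (psum≡sumBelow a j))
                          (sumBelow-≤-id (at a) j (λ t → ≤-trans (Linked⇒at-antitone (proj₁ pa) z≤n) a₀≤1)))
                        (IsPartition⇒psum≥ d pd j j≤m)
... | no j≰m = ≤-reflexive (trans (psum-≥length a j m≤j) (trans (proj₂ pa) (sym (trans (psum-≥length d j m≤j) (proj₂ pd)))))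
  where
  m≤j : m ≤ j
  m≤j = <⇒≤ (≰⇒> j≰m)

module TwoMoves {m} {a : Vec ℕ m} (pa : IsPartition m a) {i₁ j₁ i₂ j₂}
  (mv₁ : LegalMove a i₁ j₁) (mv₂ : LegalMove a i₂ j₂) where
  module M₁ = Move pa mv₁
  module M₂ = Move pa mv₂

  ⊴-via₁ : ∀ d → M₁.result ⊴ d → ∀ s → s ≤ i₁ ⊎ j₁ < s → psum a s ≤ psum d s
  ⊴-via₁ d r₁⊴d s outside = ≤-trans (≤-reflexive (sym (M₁.psum-outside s outside))) (r₁⊴d s)

  ⊴-via₂ : ∀ d → M₂.result ⊴ d → ∀ s → s ≤ i₂ ⊎ j₂ < s → psum a s ≤ psum d s
  ⊴-via₂ d r₂⊴d s outside = ≤-trans (≤-reflexive (sym (M₂.psum-outside s outside))) (r₂⊴d s)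

  properJoin : (∀ d → IsPartition m d → M₁.result ⊴ d → M₂.result ⊴ d → a ⊴ d) → IsProperJoin m a
  properJoin least = M₁.result , M₂.result , M₁.isPartition , M₂.isPartition , M₁.result◁a , M₂.result◁a ,
                     (proj₁ M₁.result◁a , proj₁ M₂.result◁a) , least

disjointMoves⇒IsProperJoin : ∀ {m} {a : Vec ℕ m} (pa : IsPartition m a) {i₁ j₁ i₂ j₂} →
  LegalMove a i₁ j₁ → LegalMove a i₂ j₂ → j₁ ≤ i₂ → IsProperJoin m a
disjointMoves⇒IsProperJoin {m} {a} pa {i₁} {j₁} mv₁ mv₂ j₁≤i₂ = properJoin least
  where
  open TwoMoves pa mv₁ mv₂
  least : ∀ d → IsPartition m d → M₁.result ⊴ d → M₂.result ⊴ d → a ⊴ d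
  least d _ r₁⊴d r₂⊴d s with splitAt i₁ j₁ s
  ... | inj₁ s≤i₁ = ⊴-via₁ d r₁⊴d s (inj₁ s≤i₁)
  ... | inj₂ (inj₂ j₁<s) = ⊴-via₁ d r₁⊴d s (inj₂ j₁<s)
  ... | inj₂ (inj₁ (_ , s≤j₁)) = ⊴-via₂ d r₂⊴d s (inj₁ (≤-trans s≤j₁ j₁≤i₂))

-- Partial sums of an antitone d dominating A at one point and A + (β+1) + β two steps later
-- also dominate A + (β+1) in between.
psum-interpolate : ∀ A D δ ε β → A ≤ D → ε ≤ δ → A + suc β + β ≤ D + δ + ε → A + suc β ≤ D + δ
psum-interpolate A D δ ε β A≤D ε≤δ two-steps with A + suc β ≤? D + δ
... | yes ok = ok
... | no too-small = ⊥-elim (1+n≰n (begin-strict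
      (A + β) + (A + β)       <⟨ ≤-reflexive (sym (lhs A β)) ⟩
      A + suc β + β + A       ≤⟨ +-mono-≤ two-steps A≤D ⟩
      D + δ + ε + D           ≡⟨ rhs D δ ε ⟩
      (D + δ) + (ε + D)       ≤⟨ +-monoʳ-≤ (D + δ) (≤-trans (+-monoˡ-≤ D ε≤δ) (≤-reflexive (+-comm δ D))) ⟩
      (D + δ) + (D + δ)       ≤⟨ +-mono-≤ D+δ≤A+β D+δ≤A+β ⟩
      (A + β) + (A + β)       ∎))
  where
  open ≤-Reasoning
  open +-*-Solver
  D+δ≤A+β : D + δ ≤ A + β
  D+δ≤A+β = ≤-pred (≤-trans (≰⇒> too-small) (≤-reflexive (+-suc A β)))
  lhs : ∀ A β → A + suc β + β + A ≡ suc ((A + β) + (A + β))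
  lhs = solve 2 (λ A β → A :+ (con 1 :+ β) :+ β :+ A := con 1 :+ ((A :+ β) :+ (A :+ β))) refl
  rhs : ∀ D δ ε → D + δ + ε + D ≡ (D + δ) + (ε + D)
  rhs = solve 3 (λ D δ ε → D :+ δ :+ ε :+ D := (D :+ δ) :+ (ε :+ D)) refl

chainedMoves⇒IsProperJoin : ∀ {m} {a : Vec ℕ m} (pa : IsPartition m a) {i₁ i₂ j₂} →
  LegalMove a i₁ (suc i₂) → LegalMove a i₂ j₂ → at a i₂ ≡ suc (at a (suc i₂)) → IsProperJoin m a
chainedMoves⇒IsProperJoin {m} {a} pa {i₁} {i₂} mv₁ mv₂ step = properJoin least
  where
  open TwoMoves pa mv₁ mv₂
  least : ∀ d → IsPartition m d → M₁.result ⊴ d → M₂.result ⊴ d → a ⊴ d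
  least d pd r₁⊴d r₂⊴d s with splitAt i₁ (suc i₂) s
  ... | inj₁ s≤i₁ = ⊴-via₁ d r₁⊴d s (inj₁ s≤i₁)
  ... | inj₂ (inj₂ j₁<s) = ⊴-via₁ d r₁⊴d s (inj₂ j₁<s)
  ... | inj₂ (inj₁ (_ , s≤i₂+1)) with s ≤? i₂
  ...   | yes s≤i₂ = ⊴-via₂ d r₂⊴d s (inj₁ s≤i₂)
  ...   | no s≰i₂ rewrite ≤-antisym s≤i₂+1 (≰⇒> s≰i₂) =
          subst₂ _≤_ (sym psum-a) (sym (psum-suc d i₂))
            (psum-interpolate (psum a i₂) (psum d i₂) (at d i₂) (at d (suc i₂)) β
              (⊴-via₂ d r₂⊴d i₂ (inj₁ ≤-refl))
              (Linked⇒at-suc≤ (proj₁ pd) i₂)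
              (subst₂ _≤_ psum-a₂ psum-d₂ (⊴-via₁ d r₁⊴d (suc (suc i₂)) (inj₂ ≤-refl))))
    where
    β = at a (suc i₂)
    psum-a : psum a (suc i₂) ≡ psum a i₂ + suc β
    psum-a = trans (psum-suc a i₂) (cong (psum a i₂ +_) step)
    psum-a₂ : psum a (suc (suc i₂)) ≡ psum a i₂ + suc β + β
    psum-a₂ = trans (psum-suc a (suc i₂)) (cong (_+ β) psum-a)
    psum-d₂ : psum d (suc (suc i₂)) ≡ psum d i₂ + at d i₂ + at d (suc i₂)
    psum-d₂ = trans (psum-suc d (suc i₂)) (cong (_+ at d (suc i₂)) (psum-suc d i₂))

-- The shapes ((h+1)^k, h^(P-k), 1^r)

abstract
  shapeEntry : (P h k r t : ℕ) → ℕ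
  shapeEntry P h k r t with t <? P
  ... | yes _ with t <? k
  ...    | yes _ = suc h
  ...    | no _ = h
  shapeEntry P h k r t | no _ with t <? P + r
  ... | yes _ = 1
  ... | no _ = 0

  shapeEntry-top : ∀ P h k r t → t < k → t < P → shapeEntry P h k r t ≡ suc h
  shapeEntry-top P h k r t t<k t<P with t <? P
  ... | no t≮P = ⊥-elim (t≮P t<P)
  ... | yes _ with t <? k
  ...   | yes _ = refl
  ...   | no t≮k = ⊥-elim (t≮k t<k)

  shapeEntry-block : ∀ P h k r t → k ≤ t → t < P → shapeEntry P h k r t ≡ h
  shapeEntry-block P h k r t k≤t t<P with t <? P
  ... | no t≮P = ⊥-elim (t≮P t<P)
  ... | yes _ with t <? k
  ...   | yes t<k = ⊥-elim (<⇒≱ t<k k≤t)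
  ...   | no _ = refl

  shapeEntry-tail : ∀ P h k r t → P ≤ t → t < P + r → shapeEntry P h k r t ≡ 1
  shapeEntry-tail P h k r t P≤t t<P+r with t <? P
  ... | yes t<P = ⊥-elim (<⇒≱ t<P P≤t)
  ... | no _ with t <? P + r
  ...   | yes _ = refl
  ...   | no t≮P+r = ⊥-elim (t≮P+r t<P+r)

  shapeEntry-zero : ∀ P h k r t → P + r ≤ t → shapeEntry P h k r t ≡ 0
  shapeEntry-zero P h k r t P+r≤t with t <? P
  ... | yes t<P = ⊥-elim (<⇒≱ t<P (≤-trans (m≤m+n P r) P+r≤t))
  ... | no _ with t <? P + r
  ...   | yes t<P+r = ⊥-elim (<⇒≱ t<P+r P+r≤t)
  ...   | no _ = refl

sumBelow-shapeEntry : ∀ P h k r e → k ≤ P → sumBelow (shapeEntry P h k r) (P + r + e) ≡ P * h + k + r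
sumBelow-shapeEntry P h k r e k≤P = begin
  sumBelow f (P + r + e)                     ≡⟨ sumBelow-+-zeros f (P + r) e (shapeEntry-zero P h k r) ⟩
  sumBelow f (P + r)                         ≡⟨ sumBelow-+-const f P r 1 (shapeEntry-tail P h k r) ⟩
  sumBelow f P + r * 1                       ≡⟨ cong (λ z → sumBelow f z + r * 1) (sym k+d≡P) ⟩
  sumBelow f (k + d) + r * 1                 ≡⟨ cong (_+ r * 1) (sumBelow-+-const f k d h
                                                   (λ t k≤t t<k+d → shapeEntry-block P h k r t k≤t (subst (t <_) k+d≡P t<k+d))) ⟩
  sumBelow f k + d * h + r * 1               ≡⟨ cong (λ z → z + d * h + r * 1) (sumBelow-+-const f 0 k (suc h)
                                                   (λ t _ t<k → shapeEntry-top P h k r t t<k (<-≤-trans t<k k≤P))) ⟩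
  0 + k * suc h + d * h + r * 1              ≡⟨ rearrange k d h r ⟩
  (k + d) * h + k + r                        ≡⟨ cong (λ z → z * h + k + r) k+d≡P ⟩
  P * h + k + r                              ∎
  where
  open ≡-Reasoning
  open +-*-Solver
  f = shapeEntry P h k r
  d = P ∸ k
  k+d≡P : k + d ≡ P
  k+d≡P = m+[n∸m]≡n k≤P
  rearrange : ∀ k d h r → 0 + k * suc h + d * h + r * 1 ≡ (k + d) * h + k + r
  rearrange = solve 4 (λ k d h r → con 0 :+ k :* (con 1 :+ h) :+ d :* h :+ r :* con 1 := (k :+ d) :* h :+ k :+ r) refl

-- Division with remainder in 1 … P rather than 0 … P-1.
quot⁺ : ℕ → ℕ → ℕ
quot⁺ M zero = 0
quot⁺ M (suc p) = pred M / suc p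

rem⁺ : ℕ → ℕ → ℕ
rem⁺ M zero = 0
rem⁺ M (suc p) = suc (pred M % suc p)

divMod⁺ : ∀ M P → 1 ≤ P → 1 ≤ M → M ≡ quot⁺ M P * P + rem⁺ M P × 1 ≤ rem⁺ M P × rem⁺ M P ≤ P
divMod⁺ (suc M) (suc p) _ _ = eq , s≤s z≤n , m%n<n M (suc p)
  where
  eq : suc M ≡ M / suc p * suc p + suc (M % suc p)
  eq = trans (cong suc (trans (m≡m%n+[m/n]*n M (suc p)) (+-comm (M % suc p) _))) (sym (+-suc _ _))

divMod⁺-< : ∀ P h₁ k₁ h₂ k₂ → h₁ < h₂ → k₁ ≤ P → 1 ≤ k₂ → h₁ * P + k₁ < h₂ * P + k₂
divMod⁺-< P h₁ k₁ h₂ k₂ h₁<h₂ k₁≤P k₂≥1 = ≤-trans (s≤s (+-monoʳ-≤ (h₁ * P) k₁≤P))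
  (subst (_≤ h₂ * P + k₂) (trans (+-comm _ 1) (cong suc (+-comm P (h₁ * P)))) (+-mono-≤ (*-monoˡ-≤ P h₁<h₂) k₂≥1))

divMod⁺-unique : ∀ P h₁ k₁ h₂ k₂ → h₁ * P + k₁ ≡ h₂ * P + k₂ → 1 ≤ k₁ → k₁ ≤ P → 1 ≤ k₂ → k₂ ≤ P → h₁ ≡ h₂ × k₁ ≡ k₂
divMod⁺-unique P h₁ k₁ h₂ k₂ eq k₁≥1 k₁≤P k₂≥1 k₂≤P with <-cmp h₁ h₂
... | tri≈ _ refl _ = refl , +-cancelˡ-≡ (h₁ * P) k₁ k₂ eq
... | tri< h₁<h₂ _ _ = ⊥-elim (<⇒≢ (divMod⁺-< P h₁ k₁ h₂ k₂ h₁<h₂ k₁≤P k₂≥1) eq)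
... | tri> _ _ h₂<h₁ = ⊥-elim (<⇒≢ (divMod⁺-< P h₂ k₂ h₁ k₁ h₂<h₁ k₂≤P k₁≥1) (sym eq))

*+-≤⇒≤ : ∀ c h k P → 1 ≤ P → suc c * P ≤ h * P + k → k ≤ P → c ≤ h
*+-≤⇒≤ c h k P P≥1 le k≤P with c ≤? h
... | yes c≤h = c≤h
... | no c≰h = ⊥-elim (<⇒≱ (≤-<-trans bound (m<n+m (c * P) P≥1)) le)
  where
  bound : h * P + k ≤ c * P
  bound = ≤-trans (+-monoʳ-≤ (h * P) k≤P) (≤-trans (≤-reflexive (+-comm (h * P) P)) (*-monoˡ-≤ P (≰⇒> c≰h)))

*+-≤⇒< : ∀ c h k P → suc c * P ≤ h * P + k → k < P → c < h
*+-≤⇒< c h k P le k<P with suc c ≤? h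
... | yes c<h = c<h
... | no c≮h = ⊥-elim (<⇒≱ bound le)
  where
  bound : h * P + k < suc c * P
  bound = ≤-trans (+-monoʳ-< (h * P) k<P) (≤-trans (≤-reflexive (+-comm (h * P) P)) (*-monoˡ-≤ P (≰⇒> c≮h)))

module _ (P h k r : ℕ) where
  private f = shapeEntry P h k r

  shapeEntry-<-≥ : ∀ t → t < P → h ≤ f t
  shapeEntry-<-≥ t t<P with t <? k
  ... | yes t<k = ≤-trans (n≤1+n h) (≤-reflexive (sym (shapeEntry-top P h k r t t<k t<P)))
  ... | no t≮k = ≤-reflexive (sym (shapeEntry-block P h k r t (≮⇒≥ t≮k) t<P))

  shapeEntry-≥-≤1 : ∀ t → P ≤ t → f t ≤ 1
  shapeEntry-≥-≤1 t P≤t with t <? P + r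
  ... | yes t<P+r = ≤-reflexive (shapeEntry-tail P h k r t P≤t t<P+r)
  ... | no t≮P+r = ≤-trans (≤-reflexive (shapeEntry-zero P h k r t (≮⇒≥ t≮P+r))) z≤n

  shapeEntry-≤ : ∀ t → f t ≤ suc h
  shapeEntry-≤ t with t <? P
  ... | no t≮P = ≤-trans (shapeEntry-≥-≤1 t (≮⇒≥ t≮P)) (s≤s z≤n)
  ... | yes t<P with t <? k
  ...   | yes t<k = ≤-reflexive (shapeEntry-top P h k r t t<k t<P)
  ...   | no t≮k = ≤-trans (≤-reflexive (shapeEntry-block P h k r t (≮⇒≥ t≮k) t<P)) (n≤1+n h)

  shapeEntry-antitone : 1 ≤ h → ∀ t → f (suc t) ≤ f t
  shapeEntry-antitone h≥1 t with suc t <? P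
  ... | no t+1≮P with t <? P
  ...   | yes t<P = ≤-trans (shapeEntry-≥-≤1 (suc t) (≮⇒≥ t+1≮P)) (≤-trans h≥1 (shapeEntry-<-≥ t t<P))
  ...   | no t≮P with suc t <? P + r
  ...     | yes t+1<P+r = ≤-reflexive (trans (shapeEntry-tail P h k r (suc t) (≮⇒≥ t+1≮P) t+1<P+r)
                            (sym (shapeEntry-tail P h k r t (≮⇒≥ t≮P) (<-trans (n<1+n t) t+1<P+r))))
  ...     | no t+1≮P+r = ≤-trans (≤-reflexive (shapeEntry-zero P h k r (suc t) (≮⇒≥ t+1≮P+r))) z≤n
  shapeEntry-antitone h≥1 t | yes t+1<P with suc t <? k
  ... | yes t+1<k = ≤-reflexive (trans (shapeEntry-top P h k r (suc t) t+1<k t+1<P)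
                      (sym (shapeEntry-top P h k r t (<-trans (n<1+n t) t+1<k) (<-trans (n<1+n t) t+1<P))))
  ... | no t+1≮k = ≤-trans (≤-reflexive (shapeEntry-block P h k r (suc t) (≮⇒≥ t+1≮k) t+1<P))
                     (shapeEntry-<-≥ t (<-trans (n<1+n t) t+1<P))

shape : (m P r : ℕ) → Vec ℕ m
shape m P r = fromFunction (shapeEntry P (quot⁺ (m ∸ r) P) (rem⁺ (m ∸ r) P) r) m

module Shape (m p h k r : ℕ) (h≥1 : 1 ≤ h) (k≥1 : 1 ≤ k) (k≤P : k ≤ suc p) (P+r≤m : suc p + r ≤ m)
  (total≡m : suc p * h + k + r ≡ m) where
  P = suc p
  V = fromFunction (shapeEntry P h k r) m

  at-V : ∀ t → at V t ≡ shapeEntry P h k r t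
  at-V = at-fromFunction _ m (λ t m≤t → shapeEntry-zero P h k r t (≤-trans P+r≤m m≤t))

  at-V-<-≥ : ∀ t → t < P → h ≤ at V t
  at-V-<-≥ t t<P = subst (h ≤_) (sym (at-V t)) (shapeEntry-<-≥ P h k r t t<P)

  at-V-≥-≤1 : ∀ t → P ≤ t → at V t ≤ 1
  at-V-≥-≤1 t P≤t = subst (_≤ 1) (sym (at-V t)) (shapeEntry-≥-≤1 P h k r t P≤t)

  at-V-≤ : ∀ t → at V t ≤ suc h
  at-V-≤ t = subst (_≤ suc h) (sym (at-V t)) (shapeEntry-≤ P h k r t)

  at-V-0 : at V 0 ≡ suc h
  at-V-0 = trans (at-V 0) (shapeEntry-top P h k r 0 k≥1 (s≤s z≤n))

  isPartition : IsPartition m V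
  isPartition = fromFunction-IsPartition _ m (λ t m≤t → shapeEntry-zero P h k r t (≤-trans P+r≤m m≤t))
    (shapeEntry-antitone P h k r h≥1)
    (trans (cong (sumBelow _) (sym (m+[n∸m]≡n P+r≤m))) (trans (sumBelow-shapeEntry P h k r _ k≤P) total≡m))

  Drop⇒<P : ∀ {i j} → Drop V i j → i < P
  Drop⇒<P {i} drop with i <? P
  ... | yes i<P = i<P
  ... | no i≮P = ⊥-elim (2≰1 (≤-trans (≤-trans (m≤m+n 2 _) drop) (at-V-≥-≤1 i (≮⇒≥ i≮P))))

  Drop⇒P≤ : ∀ {i j} → Drop V i j → P ≤ j
  Drop⇒P≤ {i} {j} drop with P ≤? j
  ... | yes P≤j = P≤j
  ... | no P≰j = ⊥-elim (1+n≰n (≤-pred (≤-trans (+-monoʳ-≤ 2 (at-V-<-≥ j (≰⇒> P≰j))) (≤-trans drop (at-V-≤ i)))))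

  -- The unique lower cover moves a unit out of row P - 1, except for (2^k, 1^(P-k)) with k < P, where it leaves row k - 1.
  ¬IsProperJoin-lastRow : P < m → Drop V p P → ¬ IsProperJoin m V
  ¬IsProperJoin-lastRow P<m drop = straddle⇒¬IsProperJoin isPartition move straddle
    where
    move : LegalMove V p P
    move = legal ≤-refl P<m (≤-trans (n≤1+n _) drop) (≤-trans (n≤1+n _) drop) (λ _ → drop)
    straddle : DropsStraddle V p P
    straddle _ _ drop′ = ≤-pred (Drop⇒<P drop′) , Drop⇒P≤ drop′

  ¬IsProperJoin-twos : h ≡ 1 → r ≡ 0 → k < P → ¬ IsProperJoin m V
  ¬IsProperJoin-twos refl refl k<P = straddle⇒¬IsProperJoin isPartition move straddle
    where
    k′ = pred k
    k′+1≡k : suc k′ ≡ k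
    k′+1≡k = suc-pred⁺ k≥1
    k′<k : k′ < k
    k′<k = subst (k′ <_) k′+1≡k ≤-refl
    at-V-k′ : at V k′ ≡ 2
    at-V-k′ = trans (at-V k′) (shapeEntry-top P 1 k 0 k′ k′<k (<-trans k′<k k<P))
    at-V-k : at V (suc k′) ≡ 1
    at-V-k = trans (cong (at V) k′+1≡k) (trans (at-V k) (shapeEntry-block P 1 k 0 k ≤-refl k<P))
    at-V-p : at V p ≡ 1
    at-V-p = trans (at-V p) (shapeEntry-block P 1 k 0 p (≤-pred k<P) ≤-refl)
    at-V-P : at V P ≡ 0
    at-V-P = trans (at-V P) (shapeEntry-zero P 1 k 0 P (≤-reflexive (+-identityʳ P)))
    P<m : P < m
    P<m = subst (P <_) total≡m (≤-trans (≤-trans (≤-reflexive (+-comm 1 P)) (+-monoʳ-≤ P k≥1))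
            (≤-reflexive (sym (trans (+-identityʳ _) (cong (_+ k) (*-identityʳ P))))))
    move : LegalMove V k′ P
    move = legal (<-trans k′<k k<P) P<m (subst₂ _<_ (sym at-V-k) (sym at-V-k′) ≤-refl)
             (subst₂ _<_ (sym at-V-P) (sym at-V-p) ≤-refl) (λ P≡k → ⊥-elim (<⇒≢ k<P (trans (sym k′+1≡k) (sym P≡k))))
    Drop⇒<k : ∀ {i j} → Drop V i j → i < k
    Drop⇒<k {i} drop with i <? k
    ... | yes i<k = i<k
    ... | no i≮k = ⊥-elim (2≰1 (≤-trans (≤-trans (m≤m+n 2 _) drop)
                     (≤-reflexive (trans (at-V i) (shapeEntry-block P 1 k 0 i (≮⇒≥ i≮k) (Drop⇒<P drop))))))
    straddle : DropsStraddle V k′ P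
    straddle _ _ drop = ≤-pred (subst (_ <_) (sym k′+1≡k) (Drop⇒<k drop)) , Drop⇒P≤ drop

Admissible : ℕ → ℕ → ℕ → Set
Admissible m P r = 1 ≤ P × P < m × (r ≡ 0 ⊎ (1 ≤ r × 3 * P + r ≤ m))

*+-≤⇒1≤ : ∀ h k P → P < h * P + k → k ≤ P → 1 ≤ h
*+-≤⇒1≤ zero k P P<k k≤P = ⊥-elim (<⇒≱ P<k k≤P)
*+-≤⇒1≤ (suc h) _ _ _ _ = s≤s z≤n

+≤⇒≤∸ : ∀ {a r m} → a + r ≤ m → a ≤ m ∸ r
+≤⇒≤∸ {a} {r} a+r≤m = subst (_≤ _ ∸ r) (m+n∸n≡m a r) (∸-monoˡ-≤ r a+r≤m)

module AdmissibleShape {m p r} (adm : Admissible m (suc p) r) where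
  P = suc p
  h = quot⁺ (m ∸ r) P
  k = rem⁺ (m ∸ r) P

  P<m : P < m
  P<m = proj₁ (proj₂ adm)

  P+r≤m : P + r ≤ m
  P+r≤m with proj₂ (proj₂ adm)
  ... | inj₁ refl = ≤-trans (≤-reflexive (+-identityʳ P)) (<⇒≤ P<m)
  ... | inj₂ (_ , 3P+r≤m) = ≤-trans (+-monoˡ-≤ r (m≤n*m P 3)) 3P+r≤m

  private
    division = divMod⁺ (m ∸ r) P (s≤s z≤n) (≤-trans (s≤s z≤n) (+≤⇒≤∸ {P} P+r≤m))

  m∸r≡ : m ∸ r ≡ h * P + k
  m∸r≡ = proj₁ division

  k≥1 : 1 ≤ k
  k≥1 = proj₁ (proj₂ division)

  k≤P : k ≤ P
  k≤P = proj₂ (proj₂ division)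

  3P≤hP+k : 1 ≤ r × 3 * P + r ≤ m → 3 * P ≤ h * P + k
  3P≤hP+k (_ , 3P+r≤m) = subst (3 * P ≤_) m∸r≡ (+≤⇒≤∸ {3 * P} 3P+r≤m)

  h≥2 : 1 ≤ r × 3 * P + r ≤ m → 2 ≤ h
  h≥2 tail = *+-≤⇒≤ 2 h k P (s≤s z≤n) (3P≤hP+k tail) k≤P

  h≥1 : 1 ≤ h
  h≥1 with proj₂ (proj₂ adm)
  ... | inj₁ refl = *+-≤⇒1≤ h k P (subst (P <_) m∸r≡ P<m) k≤P
  ... | inj₂ tail = ≤-trans (s≤s z≤n) (h≥2 tail)

  total≡m : P * h + k + r ≡ m
  total≡m = trans (cong (λ z → z + k + r) (*-comm P h))
              (trans (cong (_+ r) (sym m∸r≡)) (m∸n+n≡m (≤-trans (m≤n+m r P) P+r≤m)))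

  open Shape m p h k r h≥1 k≥1 k≤P P+r≤m total≡m public hiding (P)

  at-V-P≡0 : r ≡ 0 → at V P ≡ 0
  at-V-P≡0 refl = trans (at-V P) (shapeEntry-zero P h k 0 P (≤-reflexive (+-identityʳ P)))

  at-V-P≡1 : 1 ≤ r → at V P ≡ 1
  at-V-P≡1 r≥1 = trans (at-V P) (shapeEntry-tail P h k r P ≤-refl (m<m+n P r≥1))

  at-V-p≥ : ∀ c → (k < P → c ≤ h) → c ≤ suc h → c ≤ at V p
  at-V-p≥ c c≤h c≤h+1 with k <? P
  ... | yes k<P = ≤-trans (c≤h k<P) (at-V-<-≥ p ≤-refl)
  ... | no k≮P = ≤-trans c≤h+1 (≤-reflexive (sym (trans (at-V p)
                   (shapeEntry-top P h k r p (≤-trans ≤-refl (≮⇒≥ k≮P)) ≤-refl))))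

  ¬IsProperJoin : ¬ IsProperJoin m V
  ¬IsProperJoin with proj₂ (proj₂ adm) | k <? P | h ≤? 1
  ... | inj₁ r≡0 | yes k<P | yes h≤1 = ¬IsProperJoin-twos (≤-antisym h≤1 h≥1) r≡0 k<P
  ... | inj₁ r≡0 | yes _ | no h≰1 = ¬IsProperJoin-lastRow P<m
          (subst (λ z → 2 + z ≤ at V p) (sym (at-V-P≡0 r≡0)) (at-V-p≥ 2 (λ _ → ≰⇒> h≰1) (s≤s h≥1)))
  ... | inj₁ r≡0 | no k≮P | _ = ¬IsProperJoin-lastRow P<m
          (subst (λ z → 2 + z ≤ at V p) (sym (at-V-P≡0 r≡0)) (at-V-p≥ 2 (λ k<P → ⊥-elim (k≮P k<P)) (s≤s h≥1)))
  ... | inj₂ tail | _ | _ = ¬IsProperJoin-lastRow P<m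
          (subst (λ z → 2 + z ≤ at V p) (sym (at-V-P≡1 (proj₁ tail)))
            (at-V-p≥ 3 (*+-≤⇒< 2 h k P (3P≤hP+k tail)) (s≤s (h≥2 tail))))

shape-JoinIrreducible : ∀ {n P r} → Admissible (suc n) P r → JoinIrreducible (suc n) (shape (suc n) P r)
shape-JoinIrreducible {P = suc p} adm =
  isPartition , head≥2⇒¬IsLeast V (subst (2 ≤_) (sym at-V-0) (s≤s h≥1)) , ¬IsProperJoin
  where open AdmissibleShape adm

countPrefix : ∀ {m} → ℕ → Vec ℕ m → ℕ
countPrefix v [] = 0
countPrefix v (x ∷ xs) with v ≤? x
... | yes _ = suc (countPrefix v xs)
... | no _ = 0

<countPrefix⇒≤ : ∀ {m} v (a : Vec ℕ m) t → t < countPrefix v a → v ≤ at a t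
<countPrefix⇒≤ v (x ∷ a) t t<c with v ≤? x
<countPrefix⇒≤ v (x ∷ a) zero _ | yes v≤x = v≤x
<countPrefix⇒≤ v (x ∷ a) (suc t) (s≤s t<c) | yes _ = <countPrefix⇒≤ v a t t<c

at-countPrefix< : ∀ {m} v (a : Vec ℕ m) → 1 ≤ v → at a (countPrefix v a) < v
at-countPrefix< v [] v≥1 = v≥1
at-countPrefix< v (x ∷ a) v≥1 with v ≤? x
... | yes _ = at-countPrefix< v a v≥1
... | no v≰x = ≰⇒> v≰x

module _ {m} {a : Vec ℕ m} (antitone : Linked _≥_ a) {v} (v≥1 : 1 ≤ v) where

  countPrefix≤⇒< : ∀ t → countPrefix v a ≤ t → at a t < v
  countPrefix≤⇒< t c≤t = ≤-<-trans (Linked⇒at-antitone antitone c≤t) (at-countPrefix< v a v≥1)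

  ≤⇒<countPrefix : ∀ t → v ≤ at a t → t < countPrefix v a
  ≤⇒<countPrefix t v≤at with t <? countPrefix v a
  ... | yes t<c = t<c
  ... | no t≮c = ⊥-elim (<⇒≱ (countPrefix≤⇒< t (≮⇒≥ t≮c)) v≤at)

countPrefix-unique : ∀ {m} v (a : Vec ℕ m) c → c ≤ m → (∀ t → t < c → v ≤ at a t) → at a c < v → countPrefix v a ≡ c
countPrefix-unique v [] zero _ _ _ = refl
countPrefix-unique v (x ∷ a) zero _ _ x<v with v ≤? x
... | yes v≤x = ⊥-elim (<⇒≱ x<v v≤x)
... | no _ = refl
countPrefix-unique v (x ∷ a) (suc c) (s≤s c≤m) ≤at at<v with v ≤? x
... | yes _ = cong suc (countPrefix-unique v a c c≤m (λ t t<c → ≤at (suc t) (s≤s t<c)) at<v)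
... | no v≰x = ⊥-elim (v≰x (≤at 0 (s≤s z≤n)))

-- A 1 right after the rows ≥ 2 marks a tail of ones, unless a₀ = 2 (h = 1), when the whole support is the block.
shapeIndex : ∀ {m} → Vec ℕ m → ℕ × ℕ
shapeIndex a with at a (countPrefix 2 a) ≟ 1 | 3 ≤? at a 0
... | yes _ | yes _ = countPrefix 2 a , countPrefix 1 a ∸ countPrefix 2 a
... | _ | _ = countPrefix 1 a , 0

shapeIndex-withTail : ∀ {m} (a : Vec ℕ m) → at a (countPrefix 2 a) ≡ 1 → 3 ≤ at a 0 →
  shapeIndex a ≡ (countPrefix 2 a , countPrefix 1 a ∸ countPrefix 2 a)
shapeIndex-withTail a one three with at a (countPrefix 2 a) ≟ 1 | 3 ≤? at a 0
... | yes _ | yes _ = refl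
... | yes _ | no ¬three = ⊥-elim (¬three three)
... | no ¬one | _ = ⊥-elim (¬one one)

shapeIndex-noTail : ∀ {m} (a : Vec ℕ m) → at a (countPrefix 2 a) ≢ 1 ⊎ at a 0 < 3 → shapeIndex a ≡ (countPrefix 1 a , 0)
shapeIndex-noTail a ¬tail with at a (countPrefix 2 a) ≟ 1 | 3 ≤? at a 0
... | yes _ | no _ = refl
... | no _ | _ = refl
... | yes one | yes three with ¬tail
...   | inj₁ ¬one = ⊥-elim (¬one one)
...   | inj₂ <three = ⊥-elim (<⇒≱ <three three)

shapeIndex-shape : ∀ {m P r} → Admissible m P r → shapeIndex (shape m P r) ≡ (P , r)
shapeIndex-shape {m} {suc p} {r} adm = index (proj₂ (proj₂ adm))
  where
  open AdmissibleShape adm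
  count₁ : countPrefix 1 V ≡ P + r
  count₁ = countPrefix-unique 1 V (P + r) P+r≤m positive (s≤s (≤-reflexive (trans (at-V (P + r)) (shapeEntry-zero P h k r (P + r) ≤-refl))))
    where
    positive : ∀ t → t < P + r → 1 ≤ at V t
    positive t t<P+r with t <? P
    ... | yes t<P = ≤-trans h≥1 (at-V-<-≥ t t<P)
    ... | no t≮P = ≤-reflexive (sym (trans (at-V t) (shapeEntry-tail P h k r t (≮⇒≥ t≮P) t<P+r)))
  count₂ : 2 ≤ h → at V P < 2 → countPrefix 2 V ≡ P
  count₂ h≥2′ = countPrefix-unique 2 V P (<⇒≤ P<m) (λ t t<P → ≤-trans h≥2′ (at-V-<-≥ t t<P))
  index : r ≡ 0 ⊎ (1 ≤ r × 3 * P + r ≤ m) → shapeIndex V ≡ (P , r)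
  index (inj₁ r≡0) = trans (shapeIndex-noTail V noTail) (cong₂ _,_ (trans count₁ (trans (cong (P +_) r≡0) (+-identityʳ P))) (sym r≡0))
    where
    noTail : at V (countPrefix 2 V) ≢ 1 ⊎ at V 0 < 3
    noTail with h ≤? 1
    ... | yes h≤1 = inj₂ (subst (_< 3) (sym at-V-0) (s≤s (s≤s h≤1)))
    ... | no h≰1 = inj₁ (λ one → 0≢1+n (trans (sym (at-V-P≡0 r≡0)) (trans (cong (at V) (sym count₂P)) one)))
      where
      count₂P : countPrefix 2 V ≡ P
      count₂P = count₂ (≰⇒> h≰1) (subst (_< 2) (sym (at-V-P≡0 r≡0)) (s≤s z≤n))
  index (inj₂ tail) =
    trans (shapeIndex-withTail V (trans (cong (at V) count₂P) (at-V-P≡1 (proj₁ tail))) (subst (3 ≤_) (sym at-V-0) (s≤s (h≥2 tail))))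
          (cong₂ _,_ count₂P (trans (cong₂ _∸_ count₁ count₂P) (m+n∸m≡n P r)))
    where
    count₂P : countPrefix 2 V ≡ P
    count₂P = count₂ (h≥2 tail) (subst (_< 2) (sym (at-V-P≡1 (proj₁ tail))) ≤-refl)

-- Every join-irreducible is an admissible shape

shape-recognise : ∀ {m} (a : Vec ℕ m) → IsPartition m a → ∀ {P r h₀} → 1 ≤ P → 1 ≤ h₀ → P + r ≤ m →
  at a 0 ≡ suc h₀ →
  (∀ t → t < P → h₀ ≤ at a t) →
  (∀ t → P ≤ t → t < P + r → at a t ≡ 1) →
  (∀ t → P + r ≤ t → at a t ≡ 0) →
  a ≡ shape m P r
shape-recognise {m} a pa {P} {r} {h₀} P≥1 h₀≥1 P+r≤m at-0 block tail zeros =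
  trans a≡ (cong₂ (λ h k → fromFunction (shapeEntry P h k r) m) (sym (proj₁ params)) (sym (proj₂ params)))
  where
  K = countPrefix (suc h₀) a
  ≤top : ∀ t → at a t ≤ suc h₀
  ≤top t = ≤-trans (Linked⇒at-antitone (proj₁ pa) z≤n) (≤-reflexive at-0)
  K≥1 : 1 ≤ K
  K≥1 = ≤⇒<countPrefix (proj₁ pa) (s≤s z≤n) 0 (≤-reflexive (sym at-0))
  K≤P : K ≤ P
  K≤P with K ≤? P
  ... | yes K≤P = K≤P
  ... | no K≰P = ⊥-elim (<⇒≱ (s≤s h₀≥1) (≤-trans (<countPrefix⇒≤ (suc h₀) a P (≰⇒> K≰P)) at-P≤1))
    where
    at-P≤1 : at a P ≤ 1
    at-P≤1 with P <? P + r
    ... | yes P<P+r = ≤-reflexive (tail P ≤-refl P<P+r)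
    ... | no P≮P+r = ≤-trans (≤-reflexive (zeros P (≮⇒≥ P≮P+r))) z≤n
  at-a : ∀ t → at a t ≡ shapeEntry P h₀ K r t
  at-a t with t <? K
  ... | yes t<K = trans (≤-antisym (≤top t) (<countPrefix⇒≤ (suc h₀) a t t<K)) (sym (shapeEntry-top P h₀ K r t t<K (<-≤-trans t<K K≤P)))
  ... | no t≮K with t <? P
  ...   | yes t<P = trans (≤-antisym (≤-pred (countPrefix≤⇒< (proj₁ pa) (s≤s z≤n) t (≮⇒≥ t≮K))) (block t t<P))
                      (sym (shapeEntry-block P h₀ K r t (≮⇒≥ t≮K) t<P))
  ...   | no t≮P with t <? P + r
  ...     | yes t<P+r = trans (tail t (≮⇒≥ t≮P) t<P+r) (sym (shapeEntry-tail P h₀ K r t (≮⇒≥ t≮P) t<P+r))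
  ...     | no t≮P+r = trans (zeros t (≮⇒≥ t≮P+r)) (sym (shapeEntry-zero P h₀ K r t (≮⇒≥ t≮P+r)))
  a≡ : a ≡ fromFunction (shapeEntry P h₀ K r) m
  a≡ = at-ext a _ (λ t t<m → trans (at-a t) (sym (at-fromFunction< _ m t t<m)))
  total≡m : P * h₀ + K + r ≡ m
  total≡m = trans (sym (sumBelow-shapeEntry P h₀ K r (m ∸ (P + r)) K≤P))
    (trans (cong (sumBelow _) (m+[n∸m]≡n P+r≤m))
      (trans (sym (sumBelow-cong _ _ m (λ t _ → at-a t))) (trans (sumBelow≡total a) (proj₂ pa))))
  m∸r≡ : m ∸ r ≡ h₀ * P + K
  m∸r≡ = trans (cong (_∸ r) (sym total≡m)) (trans (m+n∸n≡m (P * h₀ + K) r) (cong (_+ K) (*-comm P h₀)))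
  division = divMod⁺ (m ∸ r) P P≥1 (≤-trans K≥1 (≤-trans (m≤n+m K (h₀ * P)) (≤-reflexive (sym m∸r≡))))
  params = divMod⁺-unique P (quot⁺ (m ∸ r) P) (rem⁺ (m ∸ r) P) h₀ K (trans (sym (proj₁ division)) m∸r≡)
             (proj₁ (proj₂ division)) (proj₂ (proj₂ division)) K≥1 K≤P

-- x is the largest part, y the smallest part ≥ 2, [0, N) the rows ≥ 2, [0, R) the support, [0, K) the rows equal to x.
module Profile {m} {a : Vec ℕ m} (pa : IsPartition m a) (x≥2 : 2 ≤ at a 0) where
  antitone = proj₁ pa
  x = at a 0
  N = countPrefix 2 a
  R = countPrefix 1 a
  K = countPrefix x a

  N≥1 : 1 ≤ N
  N≥1 = ≤⇒<countPrefix antitone (s≤s z≤n) 0 x≥2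
  N′ = pred N
  N′+1≡N : suc N′ ≡ N
  N′+1≡N = suc-pred⁺ N≥1
  N′<N : N′ < N
  N′<N = subst (N′ <_) N′+1≡N ≤-refl
  y = at a N′
  y≥2 : 2 ≤ y
  y≥2 = <countPrefix⇒≤ 2 a N′ N′<N
  <N⇒y≤ : ∀ t → t < N → y ≤ at a t
  <N⇒y≤ t t<N = Linked⇒at-antitone antitone (≤-pred (subst (t <_) (sym N′+1≡N) t<N))
  at-N≤1 : at a N ≤ 1
  at-N≤1 = ≤-pred (at-countPrefix< 2 a (s≤s z≤n))

  N≤R : N ≤ R
  N≤R = ≮⇒≥ (λ R<N → <⇒≱ (at-countPrefix< 1 a ≤-refl) (≤-trans (s≤s z≤n) (<countPrefix⇒≤ 2 a R R<N)))
  R≥1 : 1 ≤ R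
  R≥1 = ≤-trans N≥1 N≤R
  ≥R⇒0 : ∀ t → R ≤ t → at a t ≡ 0
  ≥R⇒0 t R≤t = n≤0⇒n≡0 (≤-pred (countPrefix≤⇒< antitone ≤-refl t R≤t))
  N≤<R⇒1 : ∀ t → N ≤ t → t < R → at a t ≡ 1
  N≤<R⇒1 t N≤t t<R = ≤-antisym (≤-pred (countPrefix≤⇒< antitone (s≤s z≤n) t N≤t)) (<countPrefix⇒≤ 1 a t t<R)
  R<m : R < m
  R<m = ≤-trans (support-sum R R≥1 ≤-refl)
          (≤-trans (≤-reflexive (sym (psum≡sumBelow a R))) (≤-trans (psum≤total a R) (≤-reflexive (proj₂ pa))))
    where
    support-sum : ∀ s → 1 ≤ s → s ≤ R → suc s ≤ sumBelow (at a) s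
    support-sum (suc zero) _ _ = x≥2
    support-sum (suc (suc s)) _ s+2≤R = ≤-trans (≤-reflexive (+-comm 1 (suc (suc s))))
      (+-mono-≤ (support-sum (suc s) (s≤s z≤n) (≤-trans (n≤1+n _) s+2≤R)) (<countPrefix⇒≤ 1 a (suc s) s+2≤R))
  N<m : N < m
  N<m = ≤-<-trans N≤R R<m

  K≥1 : 1 ≤ K
  K≥1 = ≤⇒<countPrefix antitone (≤-trans (s≤s z≤n) x≥2) 0 ≤-refl
  K′ = pred K
  K′+1≡K : suc K′ ≡ K
  K′+1≡K = suc-pred⁺ K≥1
  K′<K : K′ < K
  K′<K = subst (K′ <_) K′+1≡K ≤-refl
  <K⇒x : ∀ t → t < K → at a t ≡ x
  <K⇒x t t<K = ≤-antisym (Linked⇒at-antitone antitone z≤n) (<countPrefix⇒≤ x a t t<K)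
  at-K<x : at a (suc K′) < at a K′
  at-K<x = subst₂ _<_ (cong (at a) (sym K′+1≡K)) (sym (<K⇒x K′ K′<K)) (at-countPrefix< x a (≤-trans (s≤s z≤n) x≥2))

  moveToNext : Drop a N′ N → LegalMove a N′ N
  moveToNext drop = legal N′<N N<m (subst (λ u → suc (at a u) ≤ y) (sym N′+1≡N) (≤-trans (n≤1+n _) drop))
                      (≤-trans (n≤1+n _) drop) (λ _ → drop)

  moveToSupportEnd : at a N ≡ 1 → y ≡ 2 → LegalMove a N′ R
  moveToSupportEnd at-N≡1 y≡2 = legal (<-≤-trans N′<N N≤R) R<m
    (subst₂ _<_ (sym (trans (cong (at a) N′+1≡N) at-N≡1)) (sym y≡2) ≤-refl)
    (subst (_< at a (pred R)) (sym (≥R⇒0 R ≤-refl)) (<countPrefix⇒≤ 1 a (pred R) (subst (pred R <_) (suc-pred⁺ R≥1) ≤-refl)))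
    (λ R≡N′+1 → ⊥-elim (<⇒≢ N<R (trans (sym N′+1≡N) (sym R≡N′+1))))
    where
    N<R : N < R
    N<R = ≤⇒<countPrefix antitone ≤-refl N (≤-reflexive (sym at-N≡1))

  moveFromLastBig : ∃[ j ] LegalMove a N′ j
  moveFromLastBig with 2 + at a N ≤? y
  ... | yes drop = N , moveToNext drop
  ... | no ¬drop = R , moveToSupportEnd at-N≡1 y≡2
    where
    y≤ : y ≤ suc (at a N)
    y≤ = ≤-pred (≰⇒> ¬drop)
    y≡2 : y ≡ 2
    y≡2 = ≤-antisym (≤-trans y≤ (s≤s at-N≤1)) y≥2
    at-N≡1 : at a N ≡ 1
    at-N≡1 = ≤-antisym at-N≤1 (≤-pred (≤-trans y≥2 y≤))

  moveFromTop : 2 + y ≤ x → ∃[ j ] (LegalMove a K′ j × j ≤ N′)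
  moveFromTop y+2≤x with 2 + at a K ≤? x
  ... | yes drop = K , legal K′<K (≤-<-trans K≤N′ (<-trans N′<N N<m)) at-K<x
                         (subst (suc (at a K) ≤_) (sym (<K⇒x K′ K′<K)) (≤-trans (n≤1+n _) drop))
                         (λ _ → subst (2 + at a K ≤_) (sym (<K⇒x K′ K′<K)) drop) , K≤N′
    where
    K≤N′ : K ≤ N′
    K≤N′ = ≮⇒≥ (λ N′<K → <⇒≱ (≤-trans (n≤1+n _) y+2≤x) (≤-reflexive (sym (<K⇒x N′ N′<K))))
  ... | no ¬drop = L , legal (<-trans K′<K K<L) (≤-<-trans L≤N′ (<-trans N′<N N<m)) at-K<x
                         (≤-trans (at-countPrefix< z a z≥1) (<countPrefix⇒≤ z a (pred L) (subst (pred L <_) (suc-pred⁺ L≥1) ≤-refl)))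
                         (λ L≡K → ⊥-elim (<⇒≢ K<L (trans (sym K′+1≡K) (sym L≡K)))) , L≤N′
    where
    z = at a K
    z+1≡x : suc z ≡ x
    z+1≡x = ≤-antisym (at-countPrefix< x a (≤-trans (s≤s z≤n) x≥2)) (≤-pred (≰⇒> ¬drop))
    z≥1 : 1 ≤ z
    z≥1 = ≤-pred (≤-trans x≥2 (≤-reflexive (sym z+1≡x)))
    L = countPrefix z a
    K<L : K < L
    K<L = ≤⇒<countPrefix antitone z≥1 K ≤-refl
    L≥1 : 1 ≤ L
    L≥1 = ≤-trans (s≤s z≤n) K<L
    L≤N′ : L ≤ N′
    L≤N′ = ≮⇒≥ (λ N′<L → <⇒≱ (≤-pred (≤-trans y+2≤x (≤-reflexive (sym z+1≡x)))) (<countPrefix⇒≤ z a N′ N′<L))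

  IsShape : Set
  IsShape = ∃[ P ] ∃[ r ] (Admissible m P r × a ≡ shape m P r)

  private
    h₀ = pred x
    x≡h₀+1 : x ≡ suc h₀
    x≡h₀+1 = sym (suc-pred⁺ (≤-trans (s≤s z≤n) x≥2))
    h₀≥1 : 1 ≤ h₀
    h₀≥1 = ≤-pred (subst (2 ≤_) x≡h₀+1 x≥2)
    h₀≤y : x ≤ suc y → h₀ ≤ y
    h₀≤y x≤y+1 = ≤-pred (subst (_≤ suc y) x≡h₀+1 x≤y+1)
    no-ones : ∀ {P} t → P ≤ t → t < P + 0 → at a t ≡ 1
    no-ones {P} t P≤t t<P+0 = ⊥-elim (<⇒≱ (≤-trans t<P+0 (≤-reflexive (+-identityʳ P))) P≤t)

  noOnes⇒IsShape : x ≤ suc y → R ≡ N → IsShape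
  noOnes⇒IsShape x≤y+1 R≡N = N , 0 , (N≥1 , N<m , inj₁ refl) ,
    shape-recognise a pa N≥1 h₀≥1 (≤-trans (≤-reflexive (+-identityʳ N)) (<⇒≤ N<m)) x≡h₀+1
      (λ t t<N → ≤-trans (h₀≤y x≤y+1) (<N⇒y≤ t t<N)) no-ones
      (λ t N+0≤t → ≥R⇒0 t (≤-trans (≤-reflexive (trans R≡N (sym (+-identityʳ N)))) N+0≤t))

  twosAndOnes⇒IsShape : x ≡ 2 → IsShape
  twosAndOnes⇒IsShape x≡2 = R , 0 , (R≥1 , R<m , inj₁ refl) ,
    shape-recognise a pa R≥1 ≤-refl (≤-trans (≤-reflexive (+-identityʳ R)) (<⇒≤ R<m)) x≡2
      (λ t t<R → <countPrefix⇒≤ 1 a t t<R) no-ones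
      (λ t R+0≤t → ≥R⇒0 t (≤-trans (≤-reflexive (sym (+-identityʳ R))) R+0≤t))

  ones⇒IsShape : x ≤ suc y → 3 ≤ y → N < R → IsShape
  ones⇒IsShape x≤y+1 y≥3 N<R = N , R ∸ N , (N≥1 , N<m , inj₂ (m<n⇒0<n∸m N<R , 3N+[R∸N]≤m)) ,
    shape-recognise a pa N≥1 h₀≥1 (≤-trans (≤-reflexive N+[R∸N]≡R) (<⇒≤ R<m)) x≡h₀+1
      (λ t t<N → ≤-trans (h₀≤y x≤y+1) (<N⇒y≤ t t<N)) ones-between
      (λ t N+[R∸N]≤t → ≥R⇒0 t (subst (_≤ t) N+[R∸N]≡R N+[R∸N]≤t))
    where
    N+[R∸N]≡R : N + (R ∸ N) ≡ R
    N+[R∸N]≡R = m+[n∸m]≡n N≤R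
    ones-between : ∀ t → N ≤ t → t < N + (R ∸ N) → at a t ≡ 1
    ones-between t N≤t t<N+[R∸N] = N≤<R⇒1 t N≤t (subst (t <_) N+[R∸N]≡R t<N+[R∸N])
    3N+[R∸N]≤m : 3 * N + (R ∸ N) ≤ m
    3N+[R∸N]≤m = begin
      3 * N + (R ∸ N)                     ≡⟨ cong₂ _+_ (*-comm 3 N) (sym (*-identityʳ (R ∸ N))) ⟩
      N * 3 + (R ∸ N) * 1                 ≤⟨ +-monoˡ-≤ _ (sumBelow-≥-const (at a) 3 N (λ t t<N → ≤-trans y≥3 (<N⇒y≤ t t<N))) ⟩
      sumBelow (at a) N + (R ∸ N) * 1     ≡⟨ sym (sumBelow-+-const (at a) N (R ∸ N) 1 ones-between) ⟩
      sumBelow (at a) (N + (R ∸ N))       ≡⟨ cong (sumBelow (at a)) N+[R∸N]≡R ⟩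
      sumBelow (at a) R                   ≡⟨ sym (psum≡sumBelow a R) ⟩
      psum a R                            ≤⟨ psum≤total a R ⟩
      total a                             ≡⟨ proj₂ pa ⟩
      m                                   ∎
      where open ≤-Reasoning

  threesTwosOnes⇒IsProperJoin : x ≡ 3 → y ≡ 2 → N < R → IsProperJoin m a
  threesTwosOnes⇒IsProperJoin x≡3 y≡2 N<R = chainedMoves⇒IsProperJoin pa mv₁ mv₂ (trans y≡2 (cong suc (sym at-N′+1≡1)))
    where
    at-N≡1 : at a N ≡ 1
    at-N≡1 = N≤<R⇒1 N ≤-refl N<R
    at-N′+1≡1 : at a (suc N′) ≡ 1
    at-N′+1≡1 = trans (cong (at a) N′+1≡N) at-N≡1
    K≤N′ : K ≤ N′
    K≤N′ = ≮⇒≥ (λ N′<K → <⇒≢ (subst₂ _<_ (sym y≡2) (sym x≡3) ≤-refl) (<K⇒x N′ N′<K))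
    mv₁ : LegalMove a K′ (suc N′)
    mv₁ = legal (s≤s (≤-trans (<⇒≤ K′<K) K≤N′)) (subst (_< m) (sym N′+1≡N) N<m) at-K<x
                (subst₂ _<_ (sym at-N′+1≡1) (sym y≡2) ≤-refl)
                (λ N′+1≡K′+1 → ⊥-elim (1+n≰n (subst (_≤ N′) (trans (sym K′+1≡K) (sym N′+1≡K′+1)) K≤N′)))
    mv₂ : LegalMove a N′ R
    mv₂ = moveToSupportEnd at-N≡1 y≡2

  balanced⇒IsShape : ¬ IsProperJoin m a → x ≤ suc y → IsShape
  balanced⇒IsShape ¬join x≤y+1 with R ≟ N | x ≟ 2 | 3 ≤? y
  ... | yes R≡N | _ | _ = noOnes⇒IsShape x≤y+1 R≡N
  ... | no _ | yes x≡2 | _ = twosAndOnes⇒IsShape x≡2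
  ... | no R≢N | no _ | yes y≥3 = ones⇒IsShape x≤y+1 y≥3 (≤∧≢⇒< N≤R (λ N≡R → R≢N (sym N≡R)))
  ... | no R≢N | no x≢2 | no y≱3 = ⊥-elim (¬join (threesTwosOnes⇒IsProperJoin x≡3 y≡2 (≤∧≢⇒< N≤R (λ N≡R → R≢N (sym N≡R)))))
    where
    y≡2 : y ≡ 2
    y≡2 = ≤-antisym (≤-pred (≰⇒> y≱3)) y≥2
    x≡3 : x ≡ 3
    x≡3 = ≤-antisym (≤-trans x≤y+1 (s≤s (≤-reflexive y≡2))) (≤∧≢⇒< x≥2 (λ 2≡x → x≢2 (sym 2≡x)))

  ¬IsProperJoin⇒IsShape : ¬ IsProperJoin m a → IsShape
  ¬IsProperJoin⇒IsShape ¬join with 2 + y ≤? x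
  ... | no y+2≰x = balanced⇒IsShape ¬join (≤-pred (≰⇒> y+2≰x))
  ... | yes y+2≤x with moveFromTop y+2≤x | moveFromLastBig
  ...   | _ , mv₁ , j₁≤N′ | _ , mv₂ = ⊥-elim (¬join (disjointMoves⇒IsProperJoin pa mv₁ mv₂ j₁≤N′))

JoinIrreducible⇒shape : ∀ {m} {a : Vec ℕ m} → JoinIrreducible m a → ∃[ P ] ∃[ r ] (Admissible m P r × a ≡ shape m P r)
JoinIrreducible⇒shape {a = a} (pa , ¬least , ¬join) with at a 0 ≤? 1
... | yes a₀≤1 = ⊥-elim (¬least (head≤1⇒IsLeast a pa a₀≤1))
... | no a₀≰1 = Profile.¬IsProperJoin⇒IsShape pa (≰⇒> a₀≰1) ¬join

-- Enumerating the admissible indices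

noTailIndices : ℕ → List (ℕ × ℕ)
noTailIndices zero = []
noTailIndices (suc n) = (suc n , 0) ∷ noTailIndices n

unitBlockIndices : ℕ → List (ℕ × ℕ)
unitBlockIndices zero = []
unitBlockIndices (suc a) = (1 , suc a) ∷ unitBlockIndices a

shiftBlock : ℕ × ℕ → ℕ × ℕ
shiftBlock (P , r) = suc P , r

-- All (P, r) with P, r ≥ 1 and 3P + r ≤ a; those with P ≥ 2 come from 3(P-1) + r ≤ a - 3.
tailIndices : ℕ → List (ℕ × ℕ)
tailIndices (suc (suc (suc a))) = unitBlockIndices a ++ map shiftBlock (tailIndices a)
tailIndices _ = []

∈noTailIndices⇔ : ∀ n P r → (P , r) ∈ noTailIndices n ⇔ (r ≡ 0 × 1 ≤ P × P ≤ n)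
∈noTailIndices⇔ n P r = mk⇔ (to n) (λ (r≡0 , P≥1 , P≤n) → subst (λ r → (P , r) ∈ _) (sym r≡0) (from n P≥1 P≤n))
  where
  to : ∀ n → (P , r) ∈ noTailIndices n → r ≡ 0 × 1 ≤ P × P ≤ n
  to (suc n) (here refl) = refl , s≤s z≤n , ≤-refl
  to (suc n) (there ∈) with to n ∈
  ... | r≡0 , P≥1 , P≤n = r≡0 , P≥1 , m≤n⇒m≤1+n P≤n
  from : ∀ n → 1 ≤ P → P ≤ n → (P , 0) ∈ noTailIndices n
  from zero P≥1 P≤0 = ⊥-elim (<⇒≱ P≥1 P≤0)
  from (suc n) P≥1 P≤n+1 with P ≟ suc n
  ... | yes refl = here refl
  ... | no P≢n+1 = there (from n P≥1 (≤-pred (≤∧≢⇒< P≤n+1 P≢n+1)))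

∈unitBlockIndices⇔ : ∀ a P r → (P , r) ∈ unitBlockIndices a ⇔ (P ≡ 1 × 1 ≤ r × r ≤ a)
∈unitBlockIndices⇔ a P r = mk⇔ (to a) (λ (P≡1 , r≥1 , r≤a) → subst (λ P → (P , r) ∈ _) (sym P≡1) (from a r≥1 r≤a))
  where
  to : ∀ a → (P , r) ∈ unitBlockIndices a → P ≡ 1 × 1 ≤ r × r ≤ a
  to (suc a) (here refl) = refl , s≤s z≤n , ≤-refl
  to (suc a) (there ∈) with to a ∈
  ... | P≡1 , r≥1 , r≤a = P≡1 , r≥1 , m≤n⇒m≤1+n r≤a
  from : ∀ a → 1 ≤ r → r ≤ a → (1 , r) ∈ unitBlockIndices a
  from zero r≥1 r≤0 = ⊥-elim (<⇒≱ r≥1 r≤0)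
  from (suc a) r≥1 r≤a+1 with r ≟ suc a
  ... | yes refl = here refl
  ... | no r≢a+1 = there (from a r≥1 (≤-pred (≤∧≢⇒< r≤a+1 r≢a+1)))

3[P+1]+r≡3+[3P+r] : ∀ P r → 3 * suc P + r ≡ 3 + (3 * P + r)
3[P+1]+r≡3+[3P+r] P r = trans (cong (_+ r) (*-suc 3 P)) (+-assoc 3 (3 * P) r)

∈tailIndices⇔ : ∀ a P r → (P , r) ∈ tailIndices a ⇔ (1 ≤ P × 1 ≤ r × 3 * P + r ≤ a)
∈tailIndices⇔ a P r = mk⇔ (to a) (λ (P≥1 , r≥1 , bound) → from a P r P≥1 r≥1 bound)
  where
  to : ∀ a {P r} → (P , r) ∈ tailIndices a → 1 ≤ P × 1 ≤ r × 3 * P + r ≤ a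
  to (suc (suc (suc a))) ∈ with ∈-++⁻ (unitBlockIndices a) ∈
  ... | inj₁ ∈unit with Equivalence.to (∈unitBlockIndices⇔ a _ _) ∈unit
  ...   | refl , r≥1 , r≤a = s≤s z≤n , r≥1 , s≤s (s≤s (s≤s r≤a))
  to (suc (suc (suc a))) ∈ | inj₂ ∈shifted with ∈-map⁻ shiftBlock ∈shifted
  ... | (P , r) , ∈tail , refl with to a ∈tail
  ...   | _ , r≥1 , bound = s≤s z≤n , r≥1 , ≤-trans (≤-reflexive (3[P+1]+r≡3+[3P+r] P r)) (+-monoʳ-≤ 3 bound)
  3≤ : ∀ P r → 3 ≤ 3 * suc P + r
  3≤ P r = ≤-trans (m≤m+n 3 _) (≤-reflexive (sym (3[P+1]+r≡3+[3P+r] P r)))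
  from : ∀ a P r → 1 ≤ P → 1 ≤ r → 3 * P + r ≤ a → (P , r) ∈ tailIndices a
  from (suc (suc (suc a))) (suc zero) r _ r≥1 bound =
    ∈-++⁺ˡ (Equivalence.from (∈unitBlockIndices⇔ a 1 r) (refl , r≥1 , ≤-pred (≤-pred (≤-pred bound))))
  from (suc (suc (suc a))) (suc (suc P)) r _ r≥1 bound =
    ∈-++⁺ʳ (unitBlockIndices a) (∈-map⁺ shiftBlock (from a (suc P) r (s≤s z≤n) r≥1
      (≤-pred (≤-pred (≤-pred (subst (_≤ 3 + a) (3[P+1]+r≡3+[3P+r] (suc P) r) bound))))))
  from zero (suc P) r _ _ bound = ⊥-elim (<⇒≱ (s≤s z≤n) (≤-trans (3≤ P r) bound))
  from (suc zero) (suc P) r _ _ bound = ⊥-elim (<⇒≱ (s≤s (s≤s z≤n)) (≤-trans (3≤ P r) bound))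
  from (suc (suc zero)) (suc P) r _ _ bound = ⊥-elim (<⇒≱ (s≤s (s≤s (s≤s z≤n))) (≤-trans (3≤ P r) bound))

Unique-noTailIndices : ∀ n → Unique (noTailIndices n)
Unique-noTailIndices zero = []
Unique-noTailIndices (suc n) =
  All.tabulate (λ ∈ ≡head → 1+n≰n (proj₂ (proj₂ (Equivalence.to (∈noTailIndices⇔ n _ _) (subst (_∈ _) (sym ≡head) ∈))))) ∷
  Unique-noTailIndices n

Unique-unitBlockIndices : ∀ a → Unique (unitBlockIndices a)
Unique-unitBlockIndices zero = []
Unique-unitBlockIndices (suc a) =
  All.tabulate (λ ∈ ≡head → 1+n≰n (proj₂ (proj₂ (Equivalence.to (∈unitBlockIndices⇔ a _ _) (subst (_∈ _) (sym ≡head) ∈))))) ∷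
  Unique-unitBlockIndices a

Unique-tailIndices : ∀ a → Unique (tailIndices a)
Unique-tailIndices (suc (suc (suc a))) =
  Unique.++⁺ (Unique-unitBlockIndices a) (Unique.map⁺ shiftBlock-injective (Unique-tailIndices a)) disjoint
  where
  shiftBlock-injective : ∀ {x y} → shiftBlock x ≡ shiftBlock y → x ≡ y
  shiftBlock-injective {P , r} refl = refl
  disjoint : ∀ {v} → ¬ (v ∈ unitBlockIndices a × v ∈ map shiftBlock (tailIndices a))
  disjoint (∈unit , ∈shifted) with Equivalence.to (∈unitBlockIndices⇔ a _ _) ∈unit | ∈-map⁻ shiftBlock ∈shifted
  ... | refl , _ , _ | _ , ∈tail , refl with Equivalence.to (∈tailIndices⇔ a _ _) ∈tail
  ...   | () , _ , _
Unique-tailIndices zero = []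
Unique-tailIndices (suc zero) = []
Unique-tailIndices (suc (suc zero)) = []

admissibleIndices : ℕ → List (ℕ × ℕ)
admissibleIndices n = noTailIndices n ++ tailIndices (suc n)

∈admissibleIndices⇔ : ∀ n P r → (P , r) ∈ admissibleIndices n ⇔ Admissible (suc n) P r
∈admissibleIndices⇔ n P r = mk⇔ to from
  where
  to : (P , r) ∈ admissibleIndices n → Admissible (suc n) P r
  to ∈ with ∈-++⁻ (noTailIndices n) ∈
  ... | inj₁ ∈noTail with Equivalence.to (∈noTailIndices⇔ n P r) ∈noTail
  ...   | r≡0 , P≥1 , P≤n = P≥1 , s≤s P≤n , inj₁ r≡0
  to ∈ | inj₂ ∈tail with Equivalence.to (∈tailIndices⇔ (suc n) P r) ∈tail
  ... | P≥1 , r≥1 , bound = P≥1 , ≤-trans (≤-trans (≤-reflexive (+-comm 1 P)) (+-mono-≤ (m≤n*m P 3) r≥1)) bound , inj₂ (r≥1 , bound)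
  from : Admissible (suc n) P r → (P , r) ∈ admissibleIndices n
  from (P≥1 , P<n+1 , inj₁ r≡0) = ∈-++⁺ˡ (Equivalence.from (∈noTailIndices⇔ n P r) (r≡0 , P≥1 , ≤-pred P<n+1))
  from (P≥1 , _ , inj₂ (r≥1 , bound)) = ∈-++⁺ʳ (noTailIndices n) (Equivalence.from (∈tailIndices⇔ (suc n) P r) (P≥1 , r≥1 , bound))

Unique-admissibleIndices : ∀ n → Unique (admissibleIndices n)
Unique-admissibleIndices n = Unique.++⁺ (Unique-noTailIndices n) (Unique-tailIndices (suc n)) disjoint
  where
  disjoint : ∀ {v} → ¬ (v ∈ noTailIndices n × v ∈ tailIndices (suc n))
  disjoint (∈noTail , ∈tail) with Equivalence.to (∈noTailIndices⇔ n _ _) ∈noTail | Equivalence.to (∈tailIndices⇔ (suc n) _ _) ∈tail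
  ... | refl , _ , _ | _ , () , _

length-tailIndices-+3 : ∀ a → length (tailIndices (3 + a)) ≡ a + length (tailIndices a)
length-tailIndices-+3 a = trans (length-++ (unitBlockIndices a)) (cong₂ _+_ (length-unitBlockIndices a) (length-map shiftBlock (tailIndices a)))
  where
  length-unitBlockIndices : ∀ a → length (unitBlockIndices a) ≡ a
  length-unitBlockIndices zero = refl
  length-unitBlockIndices (suc a) = cong suc (length-unitBlockIndices a)

length-admissibleIndices : ∀ n → length (admissibleIndices n) ≡ n + length (tailIndices (suc n))
length-admissibleIndices n = trans (length-++ (noTailIndices n)) (cong (_+ length (tailIndices (suc n))) (length-noTailIndices n))
  where
  length-noTailIndices : ∀ n → length (noTailIndices n) ≡ n
  length-noTailIndices zero = refl
  length-noTailIndices (suc n) = cong suc (length-noTailIndices n)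

-- The list has Σ_{P ≥ 1} max(0, n + 1 - 3P) entries; the induction steps n by 3.
length-tailIndices : ∀ n → 2 * length (tailIndices (suc n)) + 3 * (n / 3 * (n / 3)) + n / 3 ≡ 2 * (n * (n / 3))
length-tailIndices zero = refl
length-tailIndices (suc zero) = refl
length-tailIndices (suc (suc zero)) = refl
length-tailIndices (suc (suc (suc n))) = begin
  2 * T′ + 3 * (q′ * q′) + q′                    ≡⟨ cong₂ (λ T q → 2 * T + 3 * (q * q) + q) (length-tailIndices-+3 (suc n)) q′≡q+1 ⟩
  2 * (suc n + T) + 3 * (suc q * suc q) + suc q  ≡⟨ split T q n ⟩
  (2 * T + 3 * (q * q) + q) + (2 * n + 6 * q + 6) ≡⟨ cong (_+ (2 * n + 6 * q + 6)) (length-tailIndices n) ⟩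
  2 * (n * q) + (2 * n + 6 * q + 6)              ≡⟨ merge q n ⟩
  2 * (3 + n) * suc q                            ≡⟨ cong (λ q → 2 * (3 + n) * q) (sym q′≡q+1) ⟩
  2 * (3 + n) * q′                               ≡⟨ *-assoc 2 (3 + n) q′ ⟩
  2 * ((3 + n) * q′)                             ∎
  where
  open ≡-Reasoning
  open +-*-Solver
  T = length (tailIndices (suc n))
  T′ = length (tailIndices (suc (suc (suc (suc n)))))
  q = n / 3
  q′ = suc (suc (suc n)) / 3
  q′≡q+1 : q′ ≡ suc q
  q′≡q+1 = m/n≡1+[m∸n]/n {suc (suc (suc n))} {3} (s≤s (s≤s (s≤s z≤n)))
  split : ∀ T q n → 2 * (suc n + T) + 3 * (suc q * suc q) + suc q ≡ (2 * T + 3 * (q * q) + q) + (2 * n + 6 * q + 6)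
  split = solve 3 (λ T q n → con 2 :* ((con 1 :+ n) :+ T) :+ con 3 :* ((con 1 :+ q) :* (con 1 :+ q)) :+ (con 1 :+ q)
                  := (con 2 :* T :+ con 3 :* (q :* q) :+ q) :+ (con 2 :* n :+ con 6 :* q :+ con 6)) refl
  merge : ∀ q n → 2 * (n * q) + (2 * n + 6 * q + 6) ≡ 2 * (3 + n) * suc q
  merge = solve 2 (λ q n → con 2 :* (n :* q) :+ (con 2 :* n :+ con 6 :* q :+ con 6)
                  := con 2 :* (con 3 :+ n) :* (con 1 :+ q)) refl

Unique-map⁺-retraction : ∀ {A B : Set} (f : A → B) (g : B → A) {xs : List A} →
  (∀ {x} → x ∈ xs → g (f x) ≡ x) → Unique xs → Unique (map f xs)
Unique-map⁺-retraction f g {[]} _ [] = []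
Unique-map⁺-retraction f g {x ∷ xs} retract (x∉xs ∷ unique) =
  AllP.map⁺ (All.tabulate (λ y∈xs fx≡fy → All.lookup x∉xs y∈xs
    (trans (sym (retract (here refl))) (trans (cong g fx≡fy) (retract (there y∈xs)))))) ∷
  Unique-map⁺-retraction f g (λ ∈ → retract (there ∈)) unique

joinIrreducibles : (n : ℕ) → List (Vec ℕ (suc n))
joinIrreducibles n = map (λ (P , r) → shape (suc n) P r) (admissibleIndices n)

∈joinIrreducibles⇔ : ∀ n a → a ∈ joinIrreducibles n ⇔ JoinIrreducible (suc n) a
∈joinIrreducibles⇔ n a = mk⇔ to from
  where
  to : a ∈ joinIrreducibles n → JoinIrreducible (suc n) a
  to ∈ with ∈-map⁻ _ ∈
  ... | (P , r) , ∈indices , refl = shape-JoinIrreducible (Equivalence.to (∈admissibleIndices⇔ n P r) ∈indices)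
  from : JoinIrreducible (suc n) a → a ∈ joinIrreducibles n
  from irreducible with JoinIrreducible⇒shape irreducible
  ... | P , r , adm , refl = ∈-map⁺ _ (Equivalence.from (∈admissibleIndices⇔ n P r) adm)

Unique-joinIrreducibles : ∀ n → Unique (joinIrreducibles n)
Unique-joinIrreducibles n = Unique-map⁺-retraction _ shapeIndex
  (λ {(P , r)} ∈ → shapeIndex-shape (Equivalence.to (∈admissibleIndices⇔ n P r) ∈)) (Unique-admissibleIndices n)

length-joinIrreducibles : ∀ n → length (joinIrreducibles n) ≡ n + length (tailIndices (suc n))
length-joinIrreducibles n = trans (length-map _ (admissibleIndices n)) (length-admissibleIndices n)

corollary1 : (n : ℕ) → 1 ≤ n →
    Σ ℕ λ k → HasCardinality (suc n) k ×
      2 * k + 3 * ((n / 3) * (n / 3)) + n / 3 ≡ 2 * (n * (n / 3 + 1))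
corollary1 n _ =
  n + T , (joinIrreducibles n , Unique-joinIrreducibles n , ∈joinIrreducibles⇔ n , length-joinIrreducibles n) ,
  (begin
    2 * (n + T) + 3 * (q * q) + q      ≡⟨ regroup T q n ⟩
    2 * n + (2 * T + 3 * (q * q) + q)  ≡⟨ cong (2 * n +_) (length-tailIndices n) ⟩
    2 * n + 2 * (n * q)                ≡⟨ factor q n ⟩
    2 * (n * (q + 1))                  ∎)
  where
  open ≡-Reasoning
  open +-*-Solver
  T = length (tailIndices (suc n))
  q = n / 3
  regroup : ∀ T q n → 2 * (n + T) + 3 * (q * q) + q ≡ 2 * n + (2 * T + 3 * (q * q) + q)
  regroup = solve 3 (λ T q n → con 2 :* (n :+ T) :+ con 3 :* (q :* q) :+ q := con 2 :* n :+ (con 2 :* T :+ con 3 :* (q :* q) :+ q)) refl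
  factor : ∀ q n → 2 * n + 2 * (n * q) ≡ 2 * (n * (q + 1))
  factor = solve 2 (λ q n → con 2 :* n :+ con 2 :* (n :* q) := con 2 :* (n :* (q :+ con 1))) refl
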